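{- Let $n\ge 3$ and $m\ge 2$ be integers and consider the cycle-based self-similar graphs $G^{(i)}=G^{(i,m,n)}$ defined in the context. (a) If $n\ge 4$, then the average clustering coefficient of $G^{(i,m,n)}$ equals $0$ for every $i\ge 0$. (b) If $n=3$, then for every $i\ge 1$ the average clustering coefficient of $G^{(i,m,3)}$ is $$\bar{\mathcal A}\big(G^{(i,m,3)}\big)=\frac{\dfrac{3}{\binom{2(i+1)}{2}}+\displaystyle\sum_{j=1}^{i-1}\frac{|V^{(j+1)}|-|V^{(j)}|}{\binom{2(i-j+1)}{2}}+2|V^{(i)}|}{|V^{(i+1)}|},$$ where for $k\ge 0$, $|V^{(k)}|$ denotes the number of vertices of $G^{(k-1,m,3)}$ and $G^{(-1,m,3)}$ is a single vertex (an empty sum is $0$).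
   Context: The edge-path transformation replaces every edge of a graph by a path of length $m$ (inserting $m-1$ new internal vertices on each edge). The cycle-based model: $G^{(0)}=C_n$, and for $i\ge 0$, $G^{(i+1)}$ is obtained from $G^{(i)}$ by first applying the edge-path transformation, and then, for every vertex $v$ of $G^{(i)}$ (i.e. every vertex present before the subdivision), attaching a new copy of $C_n$ by identifying $v$ with one vertex of that copy. The clustering coefficient of a vertex $v$ of degree $k_v$ is $C_v=\frac{2\mathcal E_v}{k_v(k_v-1)}$, where $\mathcal E_v$ is the number of edges between neighbours of $v$; the average clustering coefficient $\bar{\mathcal A}(G)$ is the mean of $C_v$ over all vertices of $G$. -}

module Defs where

open import Data.Bool using (Bool; true; false; _∧_; _∨_; if_then_else_)
open import Data.Nat as ℕ using (ℕ; zero; suc; _+_; _*_; _∸_; _≡ᵇ_)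
open import Data.Nat.Combinatorics using (_C_)
open import Data.Integer using (+_)
open import Data.List using (List; []; _∷_; _++_; [_]; map; upTo; length; foldr)
open import Data.Nat.ListAction using (sum)
open import Data.Bool.ListAction using (any)
open import Data.Product using (_×_; _,_)
open import Data.Rational as ℚ using (ℚ; 0ℚ; _/_)

-- A finite graph: vertices are the naturals 0 .. size-1, edges an (undirected) list.
record Graph : Set where
  constructor mkGraph
  field
    size  : ℕ
    edges : List (ℕ × ℕ)
open Graph public

range : ℕ → ℕ → List ℕ
range b r = map (λ t → b + t) (upTo r)

consecutive : List ℕ → List (ℕ × ℕ)
consecutive (x ∷ y ∷ xs) = (x , y) ∷ consecutive (y ∷ xs)
consecutive _ = []

cycle : ℕ → Graph
cycle n = mkGraph n (consecutive (range 0 n ++ [ 0 ]))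

-- edge-path transformation: every edge (u,v) becomes a path of length m,
-- u - b - b+1 - ... - b+m-2 - v, with fresh internal vertices starting at label b
subdivEdges : ℕ → ℕ → List (ℕ × ℕ) → List (ℕ × ℕ)
subdivEdges m b [] = []
subdivEdges m b ((u , v) ∷ es) =
  consecutive (u ∷ range b (m ∸ 1) ++ [ v ]) ++ subdivEdges m (b + (m ∸ 1)) es

edgePath : ℕ → Graph → Graph
edgePath m g = mkGraph (size g + length (edges g) * (m ∸ 1))
                       (subdivEdges m (size g) (edges g))

-- attach a new copy of C_n at each vertex v < k, identifying v with one vertex
-- of the copy; the copy at v uses fresh labels b + v(n-1), ..., b + v(n-1) + n-2
attachEdges : ℕ → ℕ → ℕ → List (ℕ × ℕ)
attachEdges n b zero = []
attachEdges n b (suc v) =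
  attachEdges n b v ++ consecutive (v ∷ range (b + v * (n ∸ 1)) (n ∸ 1) ++ [ v ])

attachCycles : ℕ → ℕ → Graph → Graph
attachCycles n k g = mkGraph (size g + k * (n ∸ 1))
                             (edges g ++ attachEdges n (size g) k)

G : ℕ → ℕ → ℕ → Graph
G m n zero = cycle n
G m n (suc i) = attachCycles n (size (G m n i)) (edgePath m (G m n i))

adj : Graph → ℕ → ℕ → Bool
adj g a b = any (λ e → edgeIs e) (edges g)
  where
  edgeIs : ℕ × ℕ → Bool
  edgeIs (u , v) = ((u ≡ᵇ a) ∧ (v ≡ᵇ b)) ∨ ((u ≡ᵇ b) ∧ (v ≡ᵇ a))

ind : Bool → ℕ
ind true = 1
ind false = 0

vertices : Graph → List ℕ
vertices g = upTo (size g)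

degree : Graph → ℕ → ℕ
degree g v = sum (map (λ w → ind (adj g v w)) (vertices g))

nbrEdges : Graph → ℕ → ℕ
nbrEdges g v = sum (map (λ a → sum (map (λ b →
                 ind (adj g v a ∧ adj g v b ∧ adj g a b)) (upTo a))) (vertices g))

toℚ : ℕ → ℚ
toℚ k = (+ k) / 1

-- q / d, with the convention q / 0 = 0 (only used with nonzero d below,
-- except C_v for degree < 2, which never occurs in these graphs)
divN : ℚ → ℕ → ℚ
divN q zero = 0ℚ
divN q (suc d) = q ℚ.* ((+ 1) / suc d)

clustering : Graph → ℕ → ℚ
clustering g v = divN (toℚ (2 * nbrEdges g v)) (degree g v * (degree g v ∸ 1))

sumℚ : List ℚ → ℚ
sumℚ = foldr ℚ._+_ 0ℚ

avgClustering : Graph → ℚ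
avgClustering g = divN (sumℚ (map (clustering g) (vertices g))) (size g)

-- |V^(k)| = number of vertices of G^(k-1,m,n), with G^(-1) a single vertex
V : ℕ → ℕ → ℕ → ℕ
V m n zero = 1
V m n (suc k) = size (G m n k)

formulaB : ℕ → ℕ → ℚ
formulaB m i =
  divN (divN (toℚ 3) ((2 * (i + 1)) C 2)
        ℚ.+ sumℚ (map (λ j → divN (toℚ (V m 3 (j + 1)) ℚ.- toℚ (V m 3 j))
                                   ((2 * (i ∸ j + 1)) C 2))
                      (range 1 (i ∸ 1)))
        ℚ.+ toℚ (2 * V m 3 i))
       (V m 3 (i + 1))

-- Number the vertices of G^(i+1) as: the vertices of G^(i), then the interior vertices of the
-- subdivided edges, then the interior vertices of the attached cycles. Each new vertex has exactly two
-- neighbours, and these are adjacent only when the vertex lies on an attached triangle (n = 3). An old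
-- vertex gains one neighbour on every incident edge and two on its own attached cycle, so its degree
-- grows by 2 per step, and the only triangle through it is that attached cycle when n = 3. Hence for
-- n ≥ 4 all clustering coefficients vanish. For n = 3 every cycle vertex has coefficient 1 (there are
-- 2|V^(i)| of them), every subdivision vertex has 0, and an old vertex created d steps before G^(i)
-- has degree 2(d + 2) and coefficient 1 / C(2(d+2), 2); grouping the old vertices by the step that
-- created them gives the formula.

module Submission where

open import Algebra.Core using (Op₂)
open import Algebra.Structures using (IsCommutativeMonoid)
open import Data.Bool using (Bool; true; false; _∧_; _∨_; T)
open import Data.Bool.Properties
  using (∨-assoc; ∨-comm; ∨-identityʳ; ∨-zeroʳ; ∧-zeroʳ; ∧-identityʳ; ∧-conicalˡ; ∧-conicalʳ; ¬-not)
import Data.Integer as ℤ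
import Data.Integer.Properties as ℤP
import Data.Integer.Tactic.RingSolver as ℤSolver
open import Data.List using (List; []; _∷_; _++_; [_]; _∷ʳ_; foldr; map; applyUpTo; upTo; length)
open import Data.List.Properties
  using (length-++; ++-assoc; ++-identityʳ; applyUpTo-∷ʳ; length-applyUpTo; map-upTo; map-∘; map-cong)
open import Data.List.Relation.Unary.All as All using (All; []; _∷_)
open import Data.List.Relation.Unary.All.Properties using (++⁺; ++⁻ˡ; ++⁻ʳ; applyUpTo⁺₁)
open import Data.Nat using (ℕ; zero; suc; _+_; _*_; _∸_; _≡ᵇ_; _≤_; _<_; z≤n; s≤s; _≟_; _<?_)
open import Data.Nat.Combinatorics using (_C_; nC1≡n; nCk+nC[k+1]≡[n+1]C[k+1])
open import Data.Nat.ListAction using (sum)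
open import Data.Nat.Properties
open import Data.Nat.Tactic.RingSolver using (solve-∀)
open import Data.Product using (_×_; _,_; ∃; proj₁; proj₂)
open import Data.Rational as ℚ using (ℚ; 0ℚ; 1ℚ; _/_; toℚᵘ)
import Data.Rational.Properties as ℚP
import Data.Rational.Unnormalised as ℚᵘ
import Data.Rational.Unnormalised.Properties as ℚᵘP
open import Data.Sum using (_⊎_; inj₁; inj₂; [_,_]′)
open import Function using (_∘_)
open import Relation.Binary using (tri<; tri≈; tri>)
open import Relation.Binary.PropositionalEquality hiding ([_])
open import Relation.Nullary using (Dec; contradiction; yes; no)
open import Relation.Nullary.Decidable using (dec-true; dec-false)
open import Defs

module FiniteSum {A : Set} {_+ᴬ_ : Op₂ A} {0ᴬ : A} (isCM : IsCommutativeMonoid _≡_ _+ᴬ_ 0ᴬ) where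
  open IsCommutativeMonoid isCM using (assoc; comm; identityˡ; identityʳ)
  open ≡-Reasoning

  ∑ : ℕ → (ℕ → A) → A
  ∑ zero    f = 0ᴬ
  ∑ (suc n) f = f 0 +ᴬ ∑ n (f ∘ suc)

  foldr-applyUpTo : ∀ n (f : ℕ → A) → foldr _+ᴬ_ 0ᴬ (applyUpTo f n) ≡ ∑ n f
  foldr-applyUpTo zero    f = refl
  foldr-applyUpTo (suc n) f = cong (f 0 +ᴬ_) (foldr-applyUpTo n (f ∘ suc))

  ∑-cong : ∀ n {f g : ℕ → A} → (∀ t → t < n → f t ≡ g t) → ∑ n f ≡ ∑ n g
  ∑-cong zero    eq = refl
  ∑-cong (suc n) eq = cong₂ _+ᴬ_ (eq 0 (s≤s z≤n)) (∑-cong n (λ t t<n → eq (suc t) (s≤s t<n)))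

  ∑-split : ∀ a b (f : ℕ → A) → ∑ (a + b) f ≡ ∑ a f +ᴬ ∑ b (λ t → f (a + t))
  ∑-split zero    b f = sym (identityˡ _)
  ∑-split (suc a) b f = trans (cong (f 0 +ᴬ_) (∑-split a b (f ∘ suc))) (sym (assoc (f 0) _ _))

  ∑-zero : ∀ n (f : ℕ → A) → (∀ t → t < n → f t ≡ 0ᴬ) → ∑ n f ≡ 0ᴬ
  ∑-zero zero    f eq = refl
  ∑-zero (suc n) f eq = trans (cong₂ _+ᴬ_ (eq 0 (s≤s z≤n)) (∑-zero n (f ∘ suc) (λ t t<n → eq (suc t) (s≤s t<n))))
                              (identityˡ 0ᴬ)

  ∑-single : ∀ n (f : ℕ → A) k → k < n → (∀ t → t < n → t ≢ k → f t ≡ 0ᴬ) → ∑ n f ≡ f k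
  ∑-single (suc n) f zero    _         eq =
    trans (cong (f 0 +ᴬ_) (∑-zero n (f ∘ suc) (λ t t<n → eq (suc t) (s≤s t<n) (λ ())))) (identityʳ (f 0))
  ∑-single (suc n) f (suc k) (s≤s k<n) eq =
    trans (cong₂ _+ᴬ_ (eq 0 (s≤s z≤n) (λ ())) (∑-single n (f ∘ suc) k k<n
            (λ t t<n t≢k → eq (suc t) (s≤s t<n) (t≢k ∘ suc-injective))))
          (identityˡ (f (suc k)))

  ∑-distrib-+ : ∀ n (f g : ℕ → A) → ∑ n (λ t → f t +ᴬ g t) ≡ ∑ n f +ᴬ ∑ n g
  ∑-distrib-+ zero    f g = sym (identityˡ 0ᴬ)
  ∑-distrib-+ (suc n) f g = begin
    (f 0 +ᴬ g 0) +ᴬ ∑ n (λ t → f (suc t) +ᴬ g (suc t)) ≡⟨ cong ((f 0 +ᴬ g 0) +ᴬ_) (∑-distrib-+ n (f ∘ suc) (g ∘ suc)) ⟩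
    (f 0 +ᴬ g 0) +ᴬ (Σf +ᴬ Σg)                             ≡⟨ assoc (f 0) (g 0) (Σf +ᴬ Σg) ⟩
    f 0 +ᴬ (g 0 +ᴬ (Σf +ᴬ Σg))                             ≡⟨ cong (f 0 +ᴬ_) (sym (assoc (g 0) Σf Σg)) ⟩
    f 0 +ᴬ ((g 0 +ᴬ Σf) +ᴬ Σg)                             ≡⟨ cong (λ z → f 0 +ᴬ (z +ᴬ Σg)) (comm (g 0) Σf) ⟩
    f 0 +ᴬ ((Σf +ᴬ g 0) +ᴬ Σg)                             ≡⟨ cong (f 0 +ᴬ_) (assoc Σf (g 0) Σg) ⟩
    f 0 +ᴬ (Σf +ᴬ (g 0 +ᴬ Σg))                             ≡⟨ sym (assoc (f 0) Σf (g 0 +ᴬ Σg)) ⟩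
    (f 0 +ᴬ Σf) +ᴬ (g 0 +ᴬ Σg)                             ∎
    where
    Σf = ∑ n (f ∘ suc)
    Σg = ∑ n (g ∘ suc)

  ∑-last : ∀ n (f : ℕ → A) → ∑ (suc n) f ≡ ∑ n f +ᴬ f n
  ∑-last n f = begin
    ∑ (suc n) f                         ≡⟨ cong (λ k → ∑ k f) (+-comm 1 n) ⟩
    ∑ (n + 1) f                         ≡⟨ ∑-split n 1 f ⟩
    ∑ n f +ᴬ (f (n + 0) +ᴬ 0ᴬ)          ≡⟨ cong (∑ n f +ᴬ_) (trans (identityʳ _) (cong f (+-identityʳ n))) ⟩
    ∑ n f +ᴬ f n                        ∎

  ∑-telescope : (a : ℕ → ℕ) → (∀ j → a j ≤ a (suc j)) → ∀ k (f : ℕ → A) →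
                ∑ (a k) f ≡ ∑ (a 0) f +ᴬ ∑ k (λ j → ∑ (a (suc j) ∸ a j) (λ t → f (a j + t)))
  ∑-telescope a mono zero    f = sym (identityʳ _)
  ∑-telescope a mono (suc k) f = begin
    ∑ (a (suc k)) f                                   ≡⟨ cong (λ n → ∑ n f) (sym (m+[n∸m]≡n (mono k))) ⟩
    ∑ (a k + (a (suc k) ∸ a k)) f                     ≡⟨ ∑-split (a k) _ f ⟩
    ∑ (a k) f +ᴬ block k                              ≡⟨ cong (_+ᴬ block k) (∑-telescope a mono k f) ⟩
    (∑ (a 0) f +ᴬ ∑ k block) +ᴬ block k               ≡⟨ assoc _ _ _ ⟩
    ∑ (a 0) f +ᴬ (∑ k block +ᴬ block k)               ≡⟨ cong (∑ (a 0) f +ᴬ_) (sym (∑-last k block)) ⟩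
    ∑ (a 0) f +ᴬ ∑ (suc k) block                      ∎
    where
    block : ℕ → A
    block j = ∑ (a (suc j) ∸ a j) (λ t → f (a j + t))

open FiniteSum +-0-isCommutativeMonoid

≡ᵇ-refl : ∀ a → (a ≡ᵇ a) ≡ true
≡ᵇ-refl a = dec-true (a ≟ a) refl

≢⇒≡ᵇ-false : ∀ {a b} → a ≢ b → (a ≡ᵇ b) ≡ false
≢⇒≡ᵇ-false {a} {b} = dec-false (a ≟ b)

≡ᵇ-true⇒≡ : ∀ {a b} → (a ≡ᵇ b) ≡ true → a ≡ b
≡ᵇ-true⇒≡ {a} {b} eq = ≡ᵇ⇒≡ a b (subst T (sym eq) _)

≡ᵇ-false⇒≢ : ∀ {a b} → (a ≡ᵇ b) ≡ false → a ≢ b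
≡ᵇ-false⇒≢ {a} eq refl = contradiction (trans (sym eq) (≡ᵇ-refl a)) λ ()

ind-∨ : ∀ a b → (a ∧ b) ≡ false → ind (a ∨ b) ≡ ind a + ind b
ind-∨ true  true  ()
ind-∨ true  false _ = refl
ind-∨ false b     _ = refl

ind≡0⇒false : ∀ {a} → ind a ≡ 0 → a ≡ false
ind≡0⇒false {false} _ = refl

∨≡true⇒ : ∀ {a b} → (a ∨ b) ≡ true → a ≡ true ⊎ b ≡ true
∨≡true⇒ {true}  _  = inj₁ refl
∨≡true⇒ {false} eq = inj₂ eq

∧≡true⇒ : ∀ a {b} → (a ∧ b) ≡ true → a ≡ true × b ≡ true
∧≡true⇒ a eq = ∧-conicalˡ a _ eq , ∧-conicalʳ a _ eq

joins : ℕ → ℕ → ℕ × ℕ → Bool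
joins a b (u , v) = ((u ≡ᵇ a) ∧ (v ≡ᵇ b)) ∨ ((u ≡ᵇ b) ∧ (v ≡ᵇ a))

-- adj never looks at the vertex count, so adjacency only depends on the edge list.
adjacent : List (ℕ × ℕ) → ℕ → ℕ → Bool
adjacent E = adj (mkGraph 0 E)

adjacent-++ : ∀ E F a b → adjacent (E ++ F) a b ≡ adjacent E a b ∨ adjacent F a b
adjacent-++ []      F a b = refl
adjacent-++ (e ∷ E) F a b =
  trans (cong (joins a b e ∨_) (adjacent-++ E F a b)) (sym (∨-assoc (joins a b e) _ _))

adjacent-sym : ∀ E a b → adjacent E a b ≡ adjacent E b a
adjacent-sym []            a b = refl
adjacent-sym ((u , v) ∷ E) a b = cong₂ _∨_ (∨-comm ((u ≡ᵇ a) ∧ (v ≡ᵇ b)) _) (adjacent-sym E a b)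

adjacent-∷-apart : ∀ {a c x} E y → a ≢ x → c ≢ x → adjacent ((a , c) ∷ E) x y ≡ adjacent E x y
adjacent-∷-apart {a} {c} {x} E y a≢x c≢x rewrite ≢⇒≡ᵇ-false a≢x | ≢⇒≡ᵇ-false c≢x =
  cong (_∨ adjacent E x y) (∧-zeroʳ (a ≡ᵇ y))

adjacent-∷-fst : ∀ {a c} E y → c ≢ a → adjacent ((a , c) ∷ E) a y ≡ (c ≡ᵇ y) ∨ adjacent E a y
adjacent-∷-fst {a} {c} E y c≢a rewrite ≡ᵇ-refl a | ≢⇒≡ᵇ-false c≢a =
  cong (_∨ adjacent E a y) (trans (cong ((c ≡ᵇ y) ∨_) (∧-zeroʳ (a ≡ᵇ y))) (∨-identityʳ (c ≡ᵇ y)))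

adjacent-∷-snd : ∀ {a c} E y → a ≢ c → adjacent ((a , c) ∷ E) c y ≡ (a ≡ᵇ y) ∨ adjacent E c y
adjacent-∷-snd {a} {c} E y a≢c rewrite ≡ᵇ-refl c | ≢⇒≡ᵇ-false a≢c =
  cong (_∨ adjacent E c y) (∧-identityʳ (a ≡ᵇ y))

incidence : List (ℕ × ℕ) → ℕ → ℕ
incidence []            x = 0
incidence ((u , v) ∷ E) x = ind (u ≡ᵇ x) + ind (v ≡ᵇ x) + incidence E x

incidence-++ : ∀ E F x → incidence (E ++ F) x ≡ incidence E x + incidence F x
incidence-++ []            F x = refl
incidence-++ ((u , v) ∷ E) F x =
  trans (cong (ind (u ≡ᵇ x) + ind (v ≡ᵇ x) +_) (incidence-++ E F x))
        (sym (+-assoc (ind (u ≡ᵇ x) + ind (v ≡ᵇ x)) (incidence E x) (incidence F x)))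

incidence≡0⇒¬adjacent : ∀ E x y → incidence E x ≡ 0 → adjacent E x y ≡ false
incidence≡0⇒¬adjacent []            x y _  = refl
incidence≡0⇒¬adjacent ((u , v) ∷ E) x y eq =
  trans (adjacent-∷-apart {u} {v} {x} E y (≡ᵇ-false⇒≢ (ind≡0⇒false {u ≡ᵇ x} ind-u≡0))
                                          (≡ᵇ-false⇒≢ (ind≡0⇒false {v ≡ᵇ x} ind-v≡0)))
        (incidence≡0⇒¬adjacent E x y (m+n≡0⇒n≡0 (ind (u ≡ᵇ x) + ind (v ≡ᵇ x)) eq))
  where
  ind-u≡0 : ind (u ≡ᵇ x) ≡ 0
  ind-u≡0 = m+n≡0⇒m≡0 _ (m+n≡0⇒m≡0 _ eq)
  ind-v≡0 : ind (v ≡ᵇ x) ≡ 0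
  ind-v≡0 = m+n≡0⇒n≡0 (ind (u ≡ᵇ x)) (m+n≡0⇒m≡0 _ eq)

adjacent-++ˡ : ∀ A B z y → incidence B z ≡ 0 → adjacent (A ++ B) z y ≡ adjacent A z y
adjacent-++ˡ A B z y B∌z =
  trans (adjacent-++ A B z y) (trans (cong (adjacent A z y ∨_) (incidence≡0⇒¬adjacent B z y B∌z)) (∨-identityʳ _))

adjacent-++ʳ : ∀ A B z y → incidence A z ≡ 0 → adjacent (A ++ B) z y ≡ adjacent B z y
adjacent-++ʳ A B z y A∌z = trans (adjacent-++ A B z y) (cong (_∨ adjacent B z y) (incidence≡0⇒¬adjacent A z y A∌z))

adjacent-++ˡ′ : ∀ A B w z → incidence B z ≡ 0 → adjacent (A ++ B) w z ≡ adjacent A w z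
adjacent-++ˡ′ A B w z B∌z = trans (adjacent-sym (A ++ B) w z) (trans (adjacent-++ˡ A B z w B∌z) (adjacent-sym A z w))

adjacent-++ʳ′ : ∀ A B w z → incidence A z ≡ 0 → adjacent (A ++ B) w z ≡ adjacent B w z
adjacent-++ʳ′ A B w z A∌z = trans (adjacent-sym (A ++ B) w z) (trans (adjacent-++ʳ A B z w A∌z) (adjacent-sym B z w))

ProperEdge : ℕ → ℕ × ℕ → Set
ProperEdge n (a , c) = a < n × c < n × a ≢ c

Endpoints< : ℕ → ℕ × ℕ → Set
Endpoints< N (u , v) = u < N × v < N

Fresh : ℕ → ℕ × ℕ → Set
Fresh N (a , c) = N ≤ a ⊎ N ≤ c

adjacent-irrefl : ∀ {n} E z → All (ProperEdge n) E → adjacent E z z ≡ false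
adjacent-irrefl []            z _                      = refl
adjacent-irrefl ((a , c) ∷ E) z ((_ , _ , a≢c) ∷ prop) with a ≟ z
... | no  a≢z rewrite ≢⇒≡ᵇ-false a≢z = adjacent-irrefl E z prop
... | yes refl rewrite ≢⇒≡ᵇ-false (a≢c ∘ sym) =
  trans (cong₂ (λ p q → (p ∨ q) ∨ adjacent E a a) (∧-zeroʳ (a ≡ᵇ a)) (∧-zeroʳ (a ≡ᵇ a))) (adjacent-irrefl E a prop)

fresh⇒¬adjacent : ∀ {N} E {x y} → All (Fresh N) E → x < N → y < N → adjacent E x y ≡ false
fresh⇒¬adjacent []            _                  _   _   = refl
fresh⇒¬adjacent ((a , c) ∷ E) {x} {y} (inj₁ N≤a ∷ fresh) x<N y<N
  rewrite ≢⇒≡ᵇ-false (>⇒≢ (<-≤-trans x<N N≤a)) | ≢⇒≡ᵇ-false (>⇒≢ (<-≤-trans y<N N≤a)) =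
  fresh⇒¬adjacent E fresh x<N y<N
fresh⇒¬adjacent ((a , c) ∷ E) {x} {y} (inj₂ N≤c ∷ fresh) x<N y<N
  rewrite ≢⇒≡ᵇ-false (>⇒≢ (<-≤-trans x<N N≤c)) | ≢⇒≡ᵇ-false (>⇒≢ (<-≤-trans y<N N≤c)) =
  trans (cong₂ (λ p q → (p ∨ q) ∨ adjacent E x y) (∧-zeroʳ (a ≡ᵇ x)) (∧-zeroʳ (a ≡ᵇ y))) (fresh⇒¬adjacent E fresh x<N y<N)

path : ℕ → ℕ → ℕ → ℕ → List (ℕ × ℕ)
path u b zero    v = [ (u , v) ]
path u b (suc k) v = (u , b) ∷ path b (suc b) k v

range-suc : ∀ b k → range b (suc k) ≡ b ∷ range (suc b) k
range-suc b k = cong₂ _∷_ (+-identityʳ b) (begin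
  map (b +_) (applyUpTo suc k)      ≡⟨ cong (map (b +_)) (sym (map-upTo suc k)) ⟩
  map (b +_) (map suc (upTo k))     ≡⟨ sym (map-∘ (upTo k)) ⟩
  map ((b +_) ∘ suc) (upTo k)       ≡⟨ map-cong (+-suc b) (upTo k) ⟩
  range (suc b) k                   ∎)
  where open ≡-Reasoning

consecutive-range : ∀ k u b v → consecutive (u ∷ range b k ++ [ v ]) ≡ path u b k v
consecutive-range zero    u b v = refl
consecutive-range (suc k) u b v =
  trans (cong (λ l → consecutive (u ∷ l ++ [ v ])) (range-suc b k)) (cong ((u , b) ∷_) (consecutive-range k b (suc b) v))

pathVertex : ℕ → ℕ → ℕ → ℕ → ℕ → ℕ
pathVertex u b k       v zero    = u
pathVertex u b zero    v (suc i) = v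
pathVertex u b (suc k) v (suc i) = pathVertex b (suc b) k v i

pathVertex-inner : ∀ u b k v {i} → i < k → pathVertex u b k v (suc i) ≡ b + i
pathVertex-inner u b (suc k) v {zero}  _         = sym (+-identityʳ b)
pathVertex-inner u b (suc k) v {suc i} (s≤s i<k) = trans (pathVertex-inner b (suc b) k v i<k) (sym (+-suc b i))

pathVertex-last : ∀ u b k v → pathVertex u b k v (suc k) ≡ v
pathVertex-last u b zero    v = refl
pathVertex-last u b (suc k) v = pathVertex-last b (suc b) k v

pathVertex-injective : ∀ {u b k v i j} → u < b → v < b → i < j → j ≤ suc k →
                       pathVertex u b k v i ≡ pathVertex u b k v j → i ≡ 0 × j ≡ suc k
pathVertex-injective {u} {b} {k} {v} {zero} {suc j} u<b v<b _ (s≤s j≤k) eq with j <? k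
... | yes j<k = contradiction (trans eq (pathVertex-inner u b k v j<k)) (<⇒≢ (<-≤-trans u<b (m≤m+n b j)))
... | no  j≮k = refl , cong suc (≤-antisym j≤k (≮⇒≥ j≮k))
pathVertex-injective {u} {b} {k} {v} {suc i} {suc j} u<b v<b (s≤s i<j) (s≤s j≤k) eq with j <? k
... | yes j<k = contradiction
      (+-cancelˡ-≡ b i j (trans (sym (pathVertex-inner u b k v (<-trans i<j j<k))) (trans eq (pathVertex-inner u b k v j<k))))
      (<⇒≢ i<j)
... | no  j≮k = contradiction
      (trans (sym (pathVertex-inner u b k v (<-≤-trans i<j j≤k)))
             (trans eq (trans (cong (pathVertex u b k v ∘ suc) (≤-antisym j≤k (≮⇒≥ j≮k))) (pathVertex-last u b k v))))
      (>⇒≢ (<-≤-trans v<b (m≤m+n b i)))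

pathVertex-skip-≢ : ∀ {u b k v t} → u < b → v < b → u ≢ v ⊎ 2 ≤ k → t < k →
                    pathVertex u b k v t ≢ pathVertex u b k v (2 + t)
pathVertex-skip-≢ {u} {b} {k} {v} {t} u<b v<b short-loop-free t<k eq
  with pathVertex-injective u<b v<b (m<n+m t {2} (s≤s z≤n)) (s≤s t<k) eq
... | refl , 2≡k =
  [ (λ u≢v → u≢v (trans eq (trans (cong (pathVertex u b k v) 2≡k) (pathVertex-last u b k v))))
  , (λ 2≤k → <-irrefl refl (subst (2 ≤_) (sym (suc-injective 2≡k)) 2≤k)) ]′ short-loop-free

private
  outside-suc : ∀ {b k x} → x < b ⊎ b + suc k ≤ x → b ≢ x × (x < suc b ⊎ suc b + k ≤ x)
  outside-suc (inj₁ x<b)     = >⇒≢ x<b , inj₁ (m<n⇒m<1+n x<b)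
  outside-suc {b} {k} {x} (inj₂ b+k≤x) =
    <⇒≢ (<-≤-trans (m<m+n b (s≤s z≤n)) b+k≤x) , inj₂ (subst (_≤ x) (+-suc b k) b+k≤x)

path-incidence-outside : ∀ k u b v x → x < b ⊎ b + k ≤ x → incidence (path u b k v) x ≡ ind (u ≡ᵇ x) + ind (v ≡ᵇ x)
path-incidence-outside zero    u b v x _ = +-identityʳ _
path-incidence-outside (suc k) u b v x outside with outside-suc outside
... | b≢x , outside′ rewrite ≢⇒≡ᵇ-false b≢x | path-incidence-outside k b (suc b) v x outside′ | ≢⇒≡ᵇ-false b≢x =
  cong (_+ ind (v ≡ᵇ x)) (+-identityʳ (ind (u ≡ᵇ x)))

path-incidence-apart : ∀ {N} k u b v x → u < N → v < N → N ≤ x → x < b ⊎ b + k ≤ x → incidence (path u b k v) x ≡ 0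
path-incidence-apart k u b v x u<N v<N N≤x outside =
  trans (path-incidence-outside k u b v x outside)
        (cong₂ (λ p q → ind p + ind q) (≢⇒≡ᵇ-false (<⇒≢ (<-≤-trans u<N N≤x)))
                                       (≢⇒≡ᵇ-false (<⇒≢ (<-≤-trans v<N N≤x))))

path-incidence-inside : ∀ k u b v x → u < b → v < b → b ≤ x → x < b + k → incidence (path u b k v) x ≡ 2
path-incidence-inside zero    u b v x u<b v<b b≤x x<b+0 = contradiction (subst (x <_) (+-identityʳ b) x<b+0) (≤⇒≯ b≤x)
path-incidence-inside (suc k) u b v x u<b v<b b≤x x<b+k with b ≟ x
... | yes refl rewrite ≢⇒≡ᵇ-false (<⇒≢ u<b) | ≡ᵇ-refl b
                     | path-incidence-outside k b (suc b) v b (inj₁ (n<1+n b))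
                     | ≡ᵇ-refl b | ≢⇒≡ᵇ-false (<⇒≢ v<b) = refl
... | no  b≢x rewrite ≢⇒≡ᵇ-false (<⇒≢ (<-≤-trans u<b b≤x)) | ≢⇒≡ᵇ-false b≢x =
  path-incidence-inside k b (suc b) v x (n<1+n b) (m<n⇒m<1+n v<b) (≤∧≢⇒< b≤x b≢x) (subst (x <_) (+-suc b k) x<b+k)

path-adjacent-start : ∀ k u b v y → u < b → v ≢ u → adjacent (path u b k v) u y ≡ (pathVertex u b k v 1 ≡ᵇ y)
path-adjacent-start zero    u b v y u<b v≢u = trans (adjacent-∷-fst [] y v≢u) (∨-identityʳ (v ≡ᵇ y))
path-adjacent-start (suc k) u b v y u<b v≢u =
  trans (adjacent-∷-fst (path b (suc b) k v) y (>⇒≢ u<b))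
        (trans (cong ((b ≡ᵇ y) ∨_) (incidence≡0⇒¬adjacent (path b (suc b) k v) u y u∉path)) (∨-identityʳ (b ≡ᵇ y)))
  where
  u∉path : incidence (path b (suc b) k v) u ≡ 0
  u∉path rewrite path-incidence-outside k b (suc b) v u (inj₁ (m<n⇒m<1+n u<b))
               | ≢⇒≡ᵇ-false (>⇒≢ u<b) | ≢⇒≡ᵇ-false v≢u = refl

path-adjacent-inner : ∀ k u b v i y → u < b → v < b → i < k →
                      adjacent (path u b k v) (b + i) y ≡ (pathVertex u b k v i ≡ᵇ y) ∨ (pathVertex u b k v (2 + i) ≡ᵇ y)
path-adjacent-inner (suc k) u b v zero y u<b v<b _ rewrite +-identityʳ b =
  trans (adjacent-∷-snd (path b (suc b) k v) y (<⇒≢ u<b))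
        (cong ((u ≡ᵇ y) ∨_) (path-adjacent-start k b (suc b) v y (n<1+n b) (<⇒≢ v<b)))
path-adjacent-inner (suc k) u b v (suc i) y u<b v<b (s≤s i<k) =
  trans (adjacent-∷-apart (path b (suc b) k v) y (<⇒≢ (<-≤-trans u<b (m≤m+n b (suc i)))) (<⇒≢ (m<m+n b (s≤s z≤n))))
        (trans (cong (λ z → adjacent (path b (suc b) k v) z y) (+-suc b i))
               (path-adjacent-inner k b (suc b) v i y (n<1+n b) (m<n⇒m<1+n v<b) i<k))

path-proper-fresh : ∀ k u b v {N n} → 1 ≤ k → u < b → v < b → N ≤ b → b + k ≤ n →
                    All (λ e → ProperEdge n e × Fresh N e) (path u b k v)
path-proper-fresh (suc k) u b v {N} {n} _ u<b v<b N≤b b+k≤n =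
  ((<-≤-trans u<b (≤-trans (m≤m+n b (suc k)) b+k≤n) , <-≤-trans (m<m+n b (s≤s z≤n)) b+k≤n , <⇒≢ u<b) , inj₂ N≤b)
  ∷ inner k b v v<b N≤b (subst (_≤ n) (+-suc b k) b+k≤n)
  where
  inner : ∀ k a v → v < a → N ≤ a → suc a + k ≤ n → All (λ e → ProperEdge n e × Fresh N e) (path a (suc a) k v)
  inner zero    a v v<a N≤a a+k≤n = ((a<n , <-trans v<a a<n , >⇒≢ v<a) , inj₁ N≤a) ∷ []
    where
    a<n = ≤-trans (m≤m+n (suc a) 0) a+k≤n
  inner (suc k) a v v<a N≤a a+k≤n =
    ((≤-trans (m≤m+n (suc a) (suc k)) a+k≤n , <-≤-trans (m<m+n (suc a) (s≤s z≤n)) a+k≤n , <⇒≢ (n<1+n a)) , inj₁ N≤a)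
    ∷ inner k (suc a) v (m<n⇒m<1+n v<a) (≤-trans N≤a (n≤1+n a)) (subst (_≤ n) (+-suc (suc a) k) a+k≤n)

pathVertex-< : ∀ {u b k v} i → u < b → v < b → i ≤ suc k → pathVertex u b k v i < b + k
pathVertex-< {u} {b} {k} {v} zero    u<b _   _         = <-≤-trans u<b (m≤m+n b k)
pathVertex-< {u} {b} {k} {v} (suc i) u<b v<b (s≤s i≤k) with i <? k
... | yes i<k = subst (_< b + k) (sym (pathVertex-inner u b k v i<k)) (+-monoʳ-< b i<k)
... | no  i≮k = subst (_< b + k) (sym (trans (cong (pathVertex u b k v ∘ suc) (≤-antisym i≤k (≮⇒≥ i≮k))) (pathVertex-last u b k v)))
                      (<-≤-trans v<b (m≤m+n b k))

record PathBlock (E : List (ℕ × ℕ)) (u b k v : ℕ) : Set where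
  field
    u<b    : u < b
    v<b    : v < b
    agrees : ∀ z → b ≤ z → z < b + k → ∀ y → adjacent E z y ≡ adjacent (path u b k v) z y

path-block : ∀ {u b k v} → u < b → v < b → PathBlock (path u b k v) u b k v
path-block u<b v<b = record { u<b = u<b ; v<b = v<b ; agrees = λ _ _ _ _ → refl }

block-++ˡ : ∀ {A B u b k v} → PathBlock A u b k v → (∀ z → b ≤ z → z < b + k → incidence B z ≡ 0) →
            PathBlock (A ++ B) u b k v
block-++ˡ {A} {B} blk B∌z = record
  { u<b = u<b ; v<b = v<b
  ; agrees = λ z b≤z z<b+k y → trans (adjacent-++ˡ A B z y (B∌z z b≤z z<b+k)) (agrees z b≤z z<b+k y)
  }
  where open PathBlock blk

block-++ʳ : ∀ {A B u b k v} → PathBlock B u b k v → (∀ z → b ≤ z → z < b + k → incidence A z ≡ 0) →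
            PathBlock (A ++ B) u b k v
block-++ʳ {A} {B} blk A∌z = record
  { u<b = u<b ; v<b = v<b
  ; agrees = λ z b≤z z<b+k y → trans (adjacent-++ʳ A B z y (A∌z z b≤z z<b+k)) (agrees z b≤z z<b+k y)
  }
  where open PathBlock blk

module _ {E u b k v} (blk : PathBlock E u b k v) where
  open PathBlock blk

  private
    P : ℕ → ℕ
    P = pathVertex u b k v

    closes : 2 ≡ k → u ≡ P 3 → u ≡ v × k ≡ 2
    closes refl u≡P3 = trans u≡P3 (pathVertex-last u b 2 v) , refl

  block-vertex : ∀ {x} → b ≤ x → x < b + k → ∃ λ t → t < k × x ≡ P (suc t)
  block-vertex {x} b≤x x<b+k =
    x ∸ b , +-cancelˡ-< b _ k (subst (_< b + k) (sym (m+[n∸m]≡n b≤x)) x<b+k) ,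
    sym (trans (pathVertex-inner u b k v (+-cancelˡ-< b _ k (subst (_< b + k) (sym (m+[n∸m]≡n b≤x)) x<b+k))) (m+[n∸m]≡n b≤x))

  block-neighbours : ∀ {i} → i < k → ∀ y → adjacent E (P (suc i)) y ≡ (P i ≡ᵇ y) ∨ (P (2 + i) ≡ᵇ y)
  block-neighbours {i} i<k y = begin
    adjacent E (P (suc i)) y              ≡⟨ cong (λ z → adjacent E z y) (pathVertex-inner u b k v i<k) ⟩
    adjacent E (b + i) y                  ≡⟨ agrees (b + i) (m≤m+n b i) (+-monoʳ-< b i<k) y ⟩
    adjacent (path u b k v) (b + i) y     ≡⟨ path-adjacent-inner k u b v i y u<b v<b i<k ⟩
    (P i ≡ᵇ y) ∨ (P (2 + i) ≡ᵇ y)         ∎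
    where open ≡-Reasoning

  block-neighbour : ∀ {i y} → i < k → adjacent E (P (suc i)) y ≡ true → y ≡ P i ⊎ y ≡ P (2 + i)
  block-neighbour {i} {y} i<k adj≡true with ∨≡true⇒ (trans (sym (block-neighbours i<k y)) adj≡true)
  ... | inj₁ eq = inj₁ (sym (≡ᵇ-true⇒≡ eq))
  ... | inj₂ eq = inj₂ (sym (≡ᵇ-true⇒≡ eq))

  block-neighbours-adjacent⇒triangle : ∀ {t} → adjacent E u v ≡ false → t < k →
                                       adjacent E (P t) (P (2 + t)) ≡ true → u ≡ v × k ≡ 2
  block-neighbours-adjacent⇒triangle {suc t} _ t<k adj≡true with block-neighbour (<-trans (n<1+n t) t<k) adj≡true
  ... | inj₂ eq = contradiction (proj₁ (pathVertex-injective u<b v<b (n<1+n (2 + t)) (s≤s t<k) (sym eq))) λ ()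
  ... | inj₁ eq with pathVertex-injective u<b v<b (m<n+m t {3} (s≤s z≤n)) (s≤s t<k) (sym eq)
  ...   | refl , 3≡k = closes (suc-injective 3≡k) (sym eq)
  block-neighbours-adjacent⇒triangle {zero} u≁v 0<k adj≡true with 1 <? k
  ... | no 1≮k = contradiction (trans (sym u≁v) (subst (λ w → adjacent E u w ≡ true) P2≡v adj≡true)) λ ()
    where
    P2≡v : P 2 ≡ v
    P2≡v = trans (cong (P ∘ suc) (≤-antisym 0<k (≮⇒≥ 1≮k))) (pathVertex-last u b k v)
  ... | yes 1<k with block-neighbour 1<k (trans (adjacent-sym E (P 2) u) adj≡true)
  ...   | inj₁ u≡P1 =
    contradiction (suc-injective (proj₂ (pathVertex-injective u<b v<b (s≤s z≤n) (s≤s z≤n) u≡P1))) (<⇒≢ (<-trans (s≤s z≤n) 1<k))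
  ...   | inj₂ u≡P3 with pathVertex-injective u<b v<b (s≤s z≤n) (s≤s 1<k) u≡P3
  ...     | _ , 3≡k = closes (suc-injective 3≡k) u≡P3

  block-triangle : adjacent E u v ≡ false → ∀ {t w c} → t < k → w ≢ c →
                   adjacent E (P (suc t)) w ≡ true → adjacent E (P (suc t)) c ≡ true → adjacent E w c ≡ true →
                   ((w ≡ P t × c ≡ P (2 + t)) ⊎ (w ≡ P (2 + t) × c ≡ P t)) × u ≡ v × k ≡ 2
  block-triangle u≁v {t} t<k w≢c x~w x~c w~c with block-neighbour t<k x~w | block-neighbour t<k x~c
  ... | inj₁ refl | inj₁ refl = contradiction refl w≢c
  ... | inj₂ refl | inj₂ refl = contradiction refl w≢c
  ... | inj₁ refl | inj₂ refl = inj₁ (refl , refl) , block-neighbours-adjacent⇒triangle u≁v t<k w~c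
  ... | inj₂ refl | inj₁ refl = inj₂ (refl , refl) , block-neighbours-adjacent⇒triangle u≁v t<k (trans (adjacent-sym E _ _) w~c)

triangle-block-edges : ∀ {E u b} → PathBlock E u b 2 u →
                       adjacent E u b ≡ true × adjacent E u (suc b) ≡ true × adjacent E (suc b) b ≡ true
triangle-block-edges {E} {u} {b} blk =
  trans (adjacent-sym E u b) (trans (block-neighbours blk (s≤s z≤n) u) (cong (_∨ (suc b ≡ᵇ u)) (≡ᵇ-refl u))) ,
  trans (adjacent-sym E u (suc b))
        (trans (block-neighbours blk (s≤s (s≤s z≤n)) u) (trans (cong ((b ≡ᵇ u) ∨_) (≡ᵇ-refl u)) (∨-zeroʳ (b ≡ᵇ u)))) ,
  trans (block-neighbours blk (s≤s (s≤s z≤n)) b) (cong (_∨ (u ≡ᵇ b)) (≡ᵇ-refl b))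

triangle-block-closed : ∀ {E u b} → PathBlock E u b 2 u → ∀ {t} → t < 2 →
                        adjacent E (pathVertex u b 2 u t) (pathVertex u b 2 u (2 + t)) ≡ true
triangle-block-closed blk {zero}               _ = proj₁ (proj₂ (triangle-block-edges blk))
triangle-block-closed {E} {u} {b} blk {suc zero} _ = trans (adjacent-sym E b u) (proj₁ (triangle-block-edges blk))
triangle-block-closed blk {suc (suc _)} (s≤s (s≤s ()))

∑-adjacent-path : ∀ k u b v w → 1 ≤ k → u < b → v < b → w < b → u ≢ v ⊎ 2 ≤ k →
                  ∑ k (λ t → ind (adjacent (path u b k v) w (b + t))) ≡ ind (u ≡ᵇ w) + ind (v ≡ᵇ w)
∑-adjacent-path (suc k) u b v w _ u<b v<b w<b short-loop-free = begin
  ∑ (suc k) (λ t → ind (adjacent (path u b (suc k) v) w (b + t)))    ≡⟨ ∑-cong (suc k) split-ends ⟩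
  ∑ (suc k) (λ t → ind (P t ≡ᵇ w) + ind (P (2 + t) ≡ᵇ w))
      ≡⟨ ∑-distrib-+ (suc k) (λ t → ind (P t ≡ᵇ w)) (λ t → ind (P (2 + t) ≡ᵇ w)) ⟩
  ∑ (suc k) (λ t → ind (P t ≡ᵇ w)) + ∑ (suc k) (λ t → ind (P (2 + t) ≡ᵇ w))
      ≡⟨ cong₂ _+_ (∑-single (suc k) (λ t → ind (P t ≡ᵇ w)) 0 (s≤s z≤n) off-start)
                   (trans (∑-single (suc k) (λ t → ind (P (2 + t) ≡ᵇ w)) k ≤-refl off-end)
                          (cong (λ z → ind (z ≡ᵇ w)) (pathVertex-last u b (suc k) v))) ⟩
  ind (u ≡ᵇ w) + ind (v ≡ᵇ w)                                       ∎
  where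
  open ≡-Reasoning
  P : ℕ → ℕ
  P = pathVertex u b (suc k) v
  inner≢w : ∀ {i} → i < suc k → (P (suc i) ≡ᵇ w) ≡ false
  inner≢w {i} i<k = ≢⇒≡ᵇ-false (>⇒≢ (subst (w <_) (sym (pathVertex-inner u b (suc k) v i<k)) (<-≤-trans w<b (m≤m+n b i))))
  off-start : ∀ t → t < suc k → t ≢ 0 → ind (P t ≡ᵇ w) ≡ 0
  off-start zero    _   0≢0 = contradiction refl 0≢0
  off-start (suc t) t<k _   = cong ind (inner≢w (<-trans (n<1+n t) t<k))
  off-end : ∀ t → t < suc k → t ≢ k → ind (P (2 + t) ≡ᵇ w) ≡ 0
  off-end t t<k t≢k = cong ind (inner≢w (s≤s (≤∧≢⇒< (≤-pred t<k) t≢k)))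
  split-ends : ∀ t → t < suc k → ind (adjacent (path u b (suc k) v) w (b + t)) ≡ ind (P t ≡ᵇ w) + ind (P (2 + t) ≡ᵇ w)
  split-ends t t<k =
    trans (cong ind (trans (adjacent-sym (path u b (suc k) v) w (b + t)) (path-adjacent-inner (suc k) u b v t w u<b v<b t<k)))
          (ind-∨ (P t ≡ᵇ w) _ (¬-not not-both))
    where
    not-both : ((P t ≡ᵇ w) ∧ (P (2 + t) ≡ᵇ w)) ≢ true
    not-both both = pathVertex-skip-≢ {k = suc k} u<b v<b short-loop-free t<k
      (let Pt≡w , P2t≡w = ∧≡true⇒ (P t ≡ᵇ w) both in trans (≡ᵇ-true⇒≡ Pt≡w) (sym (≡ᵇ-true⇒≡ P2t≡w)))

sum-upTo : ∀ n (f : ℕ → ℕ) → sum (map f (upTo n)) ≡ ∑ n f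
sum-upTo n f = trans (cong sum (map-upTo f n)) (foldr-applyUpTo n f)

degree-∑ : ∀ g x → degree g x ≡ ∑ (size g) (λ y → ind (adj g x y))
degree-∑ g x = sum-upTo (size g) _

nbrEdges-∑ : ∀ g x → nbrEdges g x ≡ ∑ (size g) (λ a → ∑ a (λ c → ind (adj g x a ∧ adj g x c ∧ adj g a c)))
nbrEdges-∑ g x = trans (sum-upTo (size g) _) (∑-cong (size g) (λ a _ → sum-upTo a _))

∑-indicator : ∀ n p → p < n → ∑ n (λ y → ind (p ≡ᵇ y)) ≡ 1
∑-indicator n p p<n =
  trans (∑-single n _ p p<n (λ y _ y≢p → cong ind (≢⇒≡ᵇ-false (y≢p ∘ sym)))) (cong ind (≡ᵇ-refl p))

∑-pairs-zero : ∀ n (h : ℕ → ℕ → Bool) → (∀ a c → c < a → a < n → h a c ≢ true) →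
               ∑ n (λ a → ∑ a (λ c → ind (h a c))) ≡ 0
∑-pairs-zero n h none = ∑-zero n _ (λ a a<n → ∑-zero a _ (λ c c<a → cong ind (¬-not (none a c c<a a<n))))

∑-pairs-single : ∀ n (h : ℕ → ℕ → Bool) {a₀ c₀} → c₀ < a₀ → a₀ < n →
                 (∀ a c → c < a → a < n → h a c ≡ true → a ≡ a₀ × c ≡ c₀) →
                 ∑ n (λ a → ∑ a (λ c → ind (h a c))) ≡ ind (h a₀ c₀)
∑-pairs-single n h {a₀} {c₀} c₀<a₀ a₀<n only =
  trans (∑-single n _ a₀ a₀<n (λ a a<n a≢a₀ →
           ∑-zero a _ (λ c c<a → cong ind (¬-not (a≢a₀ ∘ proj₁ ∘ only a c c<a a<n)))))
        (∑-single a₀ _ c₀ c₀<a₀ (λ c c<a₀ c≢c₀ → cong ind (¬-not (c≢c₀ ∘ proj₂ ∘ only a₀ c c<a₀ a₀<n))))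

module _ (g : Graph) (x p q : ℕ) (neighbours : ∀ y → adj g x y ≡ (p ≡ᵇ y) ∨ (q ≡ᵇ y)) where

  private
    neighbour : ∀ {y} → adj g x y ≡ true → y ≡ p ⊎ y ≡ q
    neighbour {y} adj≡true with ∨≡true⇒ {p ≡ᵇ y} (trans (sym (neighbours y)) adj≡true)
    ... | inj₁ eq = inj₁ (sym (≡ᵇ-true⇒≡ eq))
    ... | inj₂ eq = inj₂ (sym (≡ᵇ-true⇒≡ eq))

  two-neighbours-degree : p ≢ q → p < size g → q < size g → degree g x ≡ 2
  two-neighbours-degree p≢q p<n q<n = begin
    degree g x                                                        ≡⟨ degree-∑ g x ⟩
    ∑ (size g) (λ y → ind (adj g x y))                                ≡⟨ ∑-cong (size g) (λ y _ → cong ind (neighbours y)) ⟩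
    ∑ (size g) (λ y → ind ((p ≡ᵇ y) ∨ (q ≡ᵇ y)))
      ≡⟨ ∑-cong (size g) (λ y _ → ind-∨ (p ≡ᵇ y) _ (not-both y)) ⟩
    ∑ (size g) (λ y → ind (p ≡ᵇ y) + ind (q ≡ᵇ y))                    ≡⟨ ∑-distrib-+ (size g) (λ y → ind (p ≡ᵇ y)) _ ⟩
    ∑ (size g) (λ y → ind (p ≡ᵇ y)) + ∑ (size g) (λ y → ind (q ≡ᵇ y))
      ≡⟨ cong₂ _+_ (∑-indicator _ p p<n) (∑-indicator _ q q<n) ⟩
    2                                                                 ∎
    where
    open ≡-Reasoning
    not-both : ∀ y → ((p ≡ᵇ y) ∧ (q ≡ᵇ y)) ≡ false
    not-both y = ¬-not λ both →
      let p≡y , q≡y = ∧≡true⇒ (p ≡ᵇ y) both in p≢q (trans (≡ᵇ-true⇒≡ p≡y) (sym (≡ᵇ-true⇒≡ q≡y)))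

  two-neighbours-nbrEdges : q < p → p < size g → nbrEdges g x ≡ ind (adj g p q)
  two-neighbours-nbrEdges q<p p<n =
    trans (nbrEdges-∑ g x)
          (trans (∑-pairs-single (size g) h q<p p<n only)
                 (cong ind (cong₂ (λ s t → s ∧ t ∧ adj g p q) (x~ (inj₁ refl)) (x~ (inj₂ refl)))))
    where
    h : ℕ → ℕ → Bool
    h a c = adj g x a ∧ adj g x c ∧ adj g a c
    x~ : ∀ {y} → y ≡ p ⊎ y ≡ q → adj g x y ≡ true
    x~ {y} (inj₁ refl) = trans (neighbours y) (cong (_∨ (q ≡ᵇ y)) (≡ᵇ-refl y))
    x~ {y} (inj₂ refl) = trans (neighbours y) (trans (cong ((p ≡ᵇ y) ∨_) (≡ᵇ-refl y)) (∨-zeroʳ _))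
    only : ∀ a c → c < a → a < size g → h a c ≡ true → a ≡ p × c ≡ q
    only a c c<a _ h≡true with ∧≡true⇒ (adj g x a) h≡true
    ... | x~a , rest with neighbour x~a | neighbour (proj₁ (∧≡true⇒ (adj g x c) rest))
    ... | inj₁ refl | inj₁ refl = contradiction c<a (<-irrefl refl)
    ... | inj₂ refl | inj₂ refl = contradiction c<a (<-irrefl refl)
    ... | inj₁ refl | inj₂ refl = refl , refl
    ... | inj₂ refl | inj₁ refl = contradiction c<a (<-asym q<p)

two-neighbours : ∀ g x p q → (∀ y → adj g x y ≡ (p ≡ᵇ y) ∨ (q ≡ᵇ y)) → p ≢ q → p < size g → q < size g →
                 degree g x ≡ 2 × nbrEdges g x ≡ ind (adj g p q)
two-neighbours g x p q neighbours p≢q p<n q<n with <-cmp p q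
... | tri< p<q _ _ = two-neighbours-degree g x p q neighbours p≢q p<n q<n ,
                     trans (two-neighbours-nbrEdges g x q p (λ y → trans (neighbours y) (∨-comm (p ≡ᵇ y) _)) p<q q<n)
                           (cong ind (adjacent-sym (edges g) q p))
... | tri≈ _ p≡q _ = contradiction p≡q p≢q
... | tri> _ _ q<p = two-neighbours-degree g x p q neighbours p≢q p<n q<n , two-neighbours-nbrEdges g x p q neighbours q<p p<n

module _ {g u b k v} (blk : PathBlock (edges g) u b k v) (end≤ : b + k ≤ size g) where
  open PathBlock blk

  block-vertex-degree-nbrEdges : u ≢ v ⊎ 2 ≤ k → ∀ {t} → t < k →
    let P = pathVertex u b k v in degree g (P (suc t)) ≡ 2 × nbrEdges g (P (suc t)) ≡ ind (adj g (P t) (P (2 + t)))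
  block-vertex-degree-nbrEdges short-loop-free {t} t<k =
    two-neighbours g _ _ _ (block-neighbours blk t<k) (pathVertex-skip-≢ u<b v<b short-loop-free t<k)
                   (bounded t (≤-trans (<⇒≤ t<k) (n≤1+n k))) (bounded (2 + t) (s≤s t<k))
    where
    bounded : ∀ i → i ≤ suc k → pathVertex u b k v i < size g
    bounded i i≤k = <-≤-trans (pathVertex-< i u<b v<b i≤k) end≤

loops : ℕ → List (ℕ × ℕ)
loops K = applyUpTo (λ j → j , j) K

split-length< : ∀ {A : Set} {es : List A} xs {y} ys → es ≡ xs ++ y ∷ ys → length xs < length es
split-length< xs ys refl = subst (length xs <_) (sym (length-++ xs)) (m<m+n (length xs) (s≤s z≤n))

applyUpTo-at : ∀ {A : Set} (f : ℕ → A) {n} j → j < n → ∃ λ xs → ∃ λ ys → applyUpTo f n ≡ xs ++ f j ∷ ys × length xs ≡ j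
applyUpTo-at f {suc n} zero    _         = [] , applyUpTo (f ∘ suc) n , refl , refl
applyUpTo-at f {suc n} (suc j) (s≤s j<n) =
  let xs , ys , eq , len = applyUpTo-at (f ∘ suc) j j<n in f 0 ∷ xs , ys , cong (f 0 ∷_) eq , cong suc len

loops-ends : ∀ K → All (Endpoints< K) (loops K)
loops-ends K = applyUpTo⁺₁ _ K (λ j<K → j<K , j<K)

incidence-loops-≥ : ∀ K w → K ≤ w → incidence (loops K) w ≡ 0
incidence-loops-≥ zero    w _   = refl
incidence-loops-≥ (suc K) w K<w = begin
  incidence (loops (suc K)) w                                ≡⟨ cong (λ E → incidence E w) (sym (applyUpTo-∷ʳ _ K)) ⟩
  incidence (loops K ++ [ (K , K) ]) w                       ≡⟨ incidence-++ (loops K) _ w ⟩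
  incidence (loops K) w + incidence [ (K , K) ] w            ≡⟨ cong₂ _+_ (incidence-loops-≥ K w (<⇒≤ K<w))
                                                                          (cong (λ b → ind b + ind b + 0) (≢⇒≡ᵇ-false (<⇒≢ K<w))) ⟩
  0                                                          ∎
  where open ≡-Reasoning

incidence-loops-< : ∀ K w → w < K → incidence (loops K) w ≡ 2
incidence-loops-< (suc K) w w<K = begin
  incidence (loops (suc K)) w                                ≡⟨ cong (λ E → incidence E w) (sym (applyUpTo-∷ʳ _ K)) ⟩
  incidence (loops K ++ [ (K , K) ]) w                       ≡⟨ incidence-++ (loops K) _ w ⟩
  incidence (loops K) w + (ind (K ≡ᵇ w) + ind (K ≡ᵇ w) + 0)  ≡⟨ split (w ≟ K) ⟩
  2                                                          ∎
  where
  open ≡-Reasoning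
  split : Dec (w ≡ K) → incidence (loops K) w + (ind (K ≡ᵇ w) + ind (K ≡ᵇ w) + 0) ≡ 2
  split (yes refl) = cong₂ (λ p b → p + (ind b + ind b + 0)) (incidence-loops-≥ K K ≤-refl) (≡ᵇ-refl K)
  split (no w≢K)   = cong₂ (λ p b → p + (ind b + ind b + 0)) (incidence-loops-< K w (≤∧≢⇒< (≤-pred w<K) w≢K))
                                                            (≢⇒≡ᵇ-false (w≢K ∘ sym))

-- k is the number of interior vertices put on each edge, i.e. subdivEdges is used with m = k + 1.
module Subdivision (k : ℕ) where

  sub : ℕ → List (ℕ × ℕ) → List (ℕ × ℕ)
  sub = subdivEdges (suc k)

  sub-∷ : ∀ b u v es → sub b ((u , v) ∷ es) ≡ path u b k v ++ sub (b + k) es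
  sub-∷ b u v es = cong (_++ sub (b + k) es) (consecutive-range k u b v)

  sub-++ : ∀ b xs ys → sub b (xs ++ ys) ≡ sub b xs ++ sub (b + length xs * k) ys
  sub-++ b []            ys = cong (λ c → sub c ys) (sym (+-identityʳ b))
  sub-++ b ((u , v) ∷ xs) ys = begin
    Q ++ sub (b + k) (xs ++ ys)                               ≡⟨ cong (Q ++_) (sub-++ (b + k) xs ys) ⟩
    Q ++ (sub (b + k) xs ++ sub (b + k + length xs * k) ys)   ≡⟨ sym (++-assoc Q _ _) ⟩
    (Q ++ sub (b + k) xs) ++ sub (b + k + length xs * k) ys   ≡⟨ cong (λ c → (Q ++ sub (b + k) xs) ++ sub c ys) (+-assoc b k _) ⟩
    (Q ++ sub (b + k) xs) ++ sub (b + (k + length xs * k)) ys ∎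
    where
    Q = consecutive (u ∷ range b k ++ [ v ])
    open ≡-Reasoning

  attachEdges≡sub-loops : ∀ b K → attachEdges (suc k) b K ≡ sub b (loops K)
  attachEdges≡sub-loops b zero    = refl
  attachEdges≡sub-loops b (suc K) = begin
    attachEdges (suc k) b K ++ Q                   ≡⟨ cong (_++ Q) (attachEdges≡sub-loops b K) ⟩
    sub b (loops K) ++ Q                           ≡⟨ cong (sub b (loops K) ++_) (sym (++-identityʳ Q)) ⟩
    sub b (loops K) ++ sub (b + K * k) [ (K , K) ]
      ≡⟨ cong (λ n → sub b (loops K) ++ sub (b + n * k) [ (K , K) ]) (sym (length-applyUpTo _ K)) ⟩
    sub b (loops K) ++ sub (b + length (loops K) * k) [ (K , K) ] ≡⟨ sym (sub-++ b (loops K) [ (K , K) ]) ⟩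
    sub b (loops K ∷ʳ (K , K))                     ≡⟨ cong (sub b) (applyUpTo-∷ʳ _ K) ⟩
    sub b (loops (suc K))                          ∎
    where
    Q = consecutive (K ∷ range (b + K * k) k ++ [ K ])
    open ≡-Reasoning

  incidence-sub-below : ∀ b es w → w < b → incidence (sub b es) w ≡ incidence es w
  incidence-sub-below b []            w _   = refl
  incidence-sub-below b ((u , v) ∷ es) w w<b = begin
    incidence (sub b ((u , v) ∷ es)) w                          ≡⟨ cong (λ E → incidence E w) (sub-∷ b u v es) ⟩
    incidence (path u b k v ++ sub (b + k) es) w                ≡⟨ incidence-++ (path u b k v) _ w ⟩
    incidence (path u b k v) w + incidence (sub (b + k) es) w   ≡⟨ cong₂ _+_ (path-incidence-outside k u b v w (inj₁ w<b))
                                                                             (incidence-sub-below (b + k) es w (≤-trans w<b (m≤m+n b k))) ⟩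
    ind (u ≡ᵇ w) + ind (v ≡ᵇ w) + incidence es w                ∎
    where open ≡-Reasoning

  incidence-sub-outside : ∀ {N} b es x → All (Endpoints< N) es → N ≤ x → x < b ⊎ b + length es * k ≤ x →
                          incidence (sub b es) x ≡ 0
  incidence-sub-outside b []            x _                   _   _       = refl
  incidence-sub-outside b ((u , v) ∷ es) x ((u<N , v<N) ∷ ends) N≤x outside =
    trans (cong (λ E → incidence E x) (sub-∷ b u v es))
          (trans (incidence-++ (path u b k v) _ x)
                 (cong₂ _+_ (path-incidence-apart k u b v x u<N v<N N≤x (outside-path outside))
                            (incidence-sub-outside (b + k) es x ends N≤x (outside-rest outside))))
    where
    outside-path : x < b ⊎ b + (k + length es * k) ≤ x → x < b ⊎ b + k ≤ x
    outside-path (inj₁ x<b) = inj₁ x<b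
    outside-path (inj₂ ≤x)  = inj₂ (≤-trans (+-monoʳ-≤ b (m≤m+n k _)) ≤x)
    outside-rest : x < b ⊎ b + (k + length es * k) ≤ x → x < b + k ⊎ b + k + length es * k ≤ x
    outside-rest (inj₁ x<b) = inj₁ (≤-trans x<b (m≤m+n b k))
    outside-rest (inj₂ ≤x)  = inj₂ (subst (_≤ x) (sym (+-assoc b k _)) ≤x)

  incidence-sub-inside : ∀ {N} b es x → All (Endpoints< N) es → N ≤ b → b ≤ x → x < b + length es * k →
                         incidence (sub b es) x ≡ 2
  incidence-sub-inside b [] x _ _ b≤x x<b+0 = contradiction (subst (x <_) (+-identityʳ b) x<b+0) (≤⇒≯ b≤x)
  incidence-sub-inside b ((u , v) ∷ es) x ((u<N , v<N) ∷ ends) N≤b b≤x x<end =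
    trans (cong (λ E → incidence E x) (sub-∷ b u v es)) (trans (incidence-++ (path u b k v) _ x) (split (x <? b + k)))
    where
    N≤x = ≤-trans N≤b b≤x
    split : Dec (x < b + k) → incidence (path u b k v) x + incidence (sub (b + k) es) x ≡ 2
    split (yes x<b+k) =
      cong₂ _+_ (path-incidence-inside k u b v x (<-≤-trans u<N N≤b) (<-≤-trans v<N N≤b) b≤x x<b+k)
                (incidence-sub-outside (b + k) es x ends N≤x (inj₁ x<b+k))
    split (no x≮b+k) =
      cong₂ _+_ (path-incidence-apart k u b v x u<N v<N N≤x (inj₂ (≮⇒≥ x≮b+k)))
                (incidence-sub-inside (b + k) es x ends (≤-trans N≤b (m≤m+n b k)) (≮⇒≥ x≮b+k)
                                      (subst (x <_) (sym (+-assoc b k _)) x<end))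

  record Located (b : ℕ) (es : List (ℕ × ℕ)) (x : ℕ) : Set where
    constructor located
    field
      before : List (ℕ × ℕ)
      u v    : ℕ
      after  : List (ℕ × ℕ)
      split  : es ≡ before ++ (u , v) ∷ after
      lower  : b + length before * k ≤ x
      upper  : x < b + length before * k + k

  locate : ∀ b es x → b ≤ x → x < b + length es * k → Located b es x
  locate b [] x b≤x x<b+0 = contradiction (subst (x <_) (+-identityʳ b) x<b+0) (≤⇒≯ b≤x)
  locate b ((u , v) ∷ es) x b≤x x<end with x <? b + k
  ... | yes x<b+k = located [] u v es refl (subst (_≤ x) (sym (+-identityʳ b)) b≤x) (subst (λ c → x < c + k) (sym (+-identityʳ b)) x<b+k)
  ... | no  x≮b+k =
    let located xs u′ v′ ys eq lo hi = locate (b + k) es x (≮⇒≥ x≮b+k) (subst (x <_) (sym (+-assoc b k _)) x<end)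
    in  located ((u , v) ∷ xs) u′ v′ ys (cong ((u , v) ∷_) eq)
                (subst (_≤ x) (+-assoc b k _) lo) (subst (λ c → x < c + k) (+-assoc b k _) hi)

  sub-proper-fresh : ∀ {N n} b es → 1 ≤ k → All (Endpoints< N) es → N ≤ b → b + length es * k ≤ n →
                     All (λ e → ProperEdge n e × Fresh N e) (sub b es)
  sub-proper-fresh b []            _   _                    _   _     = []
  sub-proper-fresh {n = n} b ((u , v) ∷ es) 1≤k ((u<N , v<N) ∷ ends) N≤b end≤n =
    subst (All _) (sym (sub-∷ b u v es))
      (++⁺ (path-proper-fresh k u b v 1≤k (<-≤-trans u<N N≤b) (<-≤-trans v<N N≤b) N≤b
                              (≤-trans (+-monoʳ-≤ b (m≤m+n k _)) end≤n))
           (sub-proper-fresh (b + k) es 1≤k ends (≤-trans N≤b (m≤m+n b k)) (subst (_≤ n) (sym (+-assoc b k _)) end≤n)))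

  located-within : ∀ {b es x} (loc : Located b es x) → b + length (Located.before loc) * k + k ≤ b + length es * k
  located-within {b} (located xs u v ys refl _ _) = begin
    b + length xs * k + k                         ≡⟨ +-assoc b _ k ⟩
    b + (length xs * k + k)                       ≤⟨ +-monoʳ-≤ b (+-monoʳ-≤ (length xs * k) (m≤m+n k (length ys * k))) ⟩
    b + (length xs * k + suc (length ys) * k)     ≡⟨ cong (b +_) (sym (*-distribʳ-+ k (length xs) _)) ⟩
    b + (length xs + suc (length ys)) * k         ≡⟨ cong (λ n → b + n * k) (sym (length-++ xs)) ⟩
    b + length (xs ++ (u , v) ∷ ys) * k           ∎
    where open ≤-Reasoning

  sub-block : ∀ {N} b xs u v ys → All (Endpoints< N) (xs ++ (u , v) ∷ ys) → N ≤ b →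
              PathBlock (sub b (xs ++ (u , v) ∷ ys)) u (b + length xs * k) k v
  sub-block {N} b xs u v ys ends N≤b =
    subst (λ E → PathBlock E u b′ k v) (sym (trans (sub-++ b xs _) (cong (sub b xs ++_) (sub-∷ b′ u v ys))))
      (block-++ʳ {sub b xs} (block-++ˡ {B = sub (b′ + k) ys} (path-block (<-≤-trans u<N N≤b′) (<-≤-trans v<N N≤b′))
                            (λ z b′≤z z<b′+k →
                               incidence-sub-outside (b′ + k) ys z ys-ends (≤-trans N≤b′ b′≤z) (inj₁ z<b′+k)))
                 (λ z b′≤z _ → incidence-sub-outside b xs z (++⁻ˡ xs ends) (≤-trans N≤b′ b′≤z) (inj₂ b′≤z)))
    where
    b′ = b + length xs * k
    N≤b′ = ≤-trans N≤b (m≤m+n b _)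
    u<N = proj₁ (All.head (++⁻ʳ xs ends))
    v<N = proj₂ (All.head (++⁻ʳ xs ends))
    ys-ends = All.tail (++⁻ʳ xs ends)

  ∑-adjacent-sub : ∀ {N} b es w → 1 ≤ k → All (Endpoints< N) es → All (λ e → proj₁ e ≢ proj₂ e ⊎ 2 ≤ k) es →
                   N ≤ b → w < N → ∑ (length es * k) (λ t → ind (adjacent (sub b es) w (b + t))) ≡ incidence es w
  ∑-adjacent-sub b [] w _ _ _ _ _ = refl
  ∑-adjacent-sub {N} b ((u , v) ∷ es) w 1≤k ((u<N , v<N) ∷ ends) (short-loop-free ∷ slf) N≤b w<N = begin
    ∑ (k + length es * k) (λ t → ind (adjacent (sub b ((u , v) ∷ es)) w (b + t)))
      ≡⟨ ∑-split k (length es * k) _ ⟩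
    ∑ k (λ t → ind (adjacent E w (b + t))) + ∑ (length es * k) (λ t → ind (adjacent E w (b + (k + t))))
      ≡⟨ cong₂ _+_ (∑-cong k (λ t t<k → cong ind (in-path t t<k))) (∑-cong (length es * k) (λ t _ → cong ind (in-rest t))) ⟩
    ∑ k (λ t → ind (adjacent (path u b k v) w (b + t))) + ∑ (length es * k) (λ t → ind (adjacent (sub (b + k) es) w (b + k + t)))
      ≡⟨ cong₂ _+_ (∑-adjacent-path k u b v w 1≤k (<-≤-trans u<N N≤b) (<-≤-trans v<N N≤b) (<-≤-trans w<N N≤b) short-loop-free)
                   (∑-adjacent-sub (b + k) es w 1≤k ends slf (≤-trans N≤b (m≤m+n b k)) w<N) ⟩
    ind (u ≡ᵇ w) + ind (v ≡ᵇ w) + incidence es w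
      ∎
    where
    E = sub b ((u , v) ∷ es)
    open ≡-Reasoning
    in-path : ∀ t → t < k → adjacent E w (b + t) ≡ adjacent (path u b k v) w (b + t)
    in-path t t<k =
      trans (cong (λ E → adjacent E w (b + t)) (sub-∷ b u v es))
            (adjacent-++ˡ′ (path u b k v) _ w (b + t)
              (incidence-sub-outside (b + k) es (b + t) ends (≤-trans N≤b (m≤m+n b t)) (inj₁ (+-monoʳ-< b t<k))))
    in-rest : ∀ t → adjacent E w (b + (k + t)) ≡ adjacent (sub (b + k) es) w (b + k + t)
    in-rest t =
      trans (cong (λ z → adjacent E w z) (sym (+-assoc b k t)))
            (trans (cong (λ E → adjacent E w (b + k + t)) (sub-∷ b u v es))
                   (adjacent-++ʳ′ (path u b k v) _ w (b + k + t)
                     (path-incidence-apart k u b v (b + k + t) u<N v<N N≤x (inj₂ (m≤m+n (b + k) t)))))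
      where
      N≤x = ≤-trans N≤b (≤-trans (m≤m+n b k) (m≤m+n (b + k) t))

step : ℕ → ℕ → Graph → Graph
step m n g = attachCycles n (size g) (edgePath m g)

-- One step with m = r + 1 and n = s + 1: the subdivision vertices are N … S-1 and the
-- attached cycles occupy S … M-1, the cycle at the old vertex j having interior S + j s, …, S + j s + s - 1.
module Step {r s : ℕ} (1≤r : 1 ≤ r) (2≤s : 2 ≤ s) (g : Graph) (proper : All (ProperEdge (size g)) (edges g)) where
  private
    module SE = Subdivision r
    module SC = Subdivision s

  N S M : ℕ
  N = size g
  S = N + length (edges g) * r
  M = S + N * s

  g′ : Graph
  g′ = step (suc r) (suc s) g

  A B : List (ℕ × ℕ)
  A = SE.sub N (edges g)
  B = SC.sub S (loops N)

  edges-step : edges g′ ≡ A ++ B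
  edges-step = cong (A ++_) (SC.attachEdges≡sub-loops S N)

  N≤S : N ≤ S
  N≤S = m≤m+n N _

  S≤M : S ≤ M
  S≤M = m≤m+n S _

  private
    ends : All (Endpoints< N) (edges g)
    ends = All.map (λ e → proj₁ e , proj₁ (proj₂ e)) proper

    length-loops : length (loops N) ≡ N
    length-loops = length-applyUpTo _ N

    A∌ : ∀ z → S ≤ z → incidence A z ≡ 0
    A∌ z S≤z = SE.incidence-sub-outside N (edges g) z ends (≤-trans N≤S S≤z) (inj₂ S≤z)

    B∌ : ∀ z → N ≤ z → z < S → incidence B z ≡ 0
    B∌ z N≤z z<S = SC.incidence-sub-outside S (loops N) z (loops-ends N) N≤z (inj₁ z<S)

    adjacent-step-A : ∀ w y → N ≤ y → y < S → adj g′ w y ≡ adjacent A w y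
    adjacent-step-A w y N≤y y<S = trans (cong (λ E → adjacent E w y) edges-step) (adjacent-++ˡ′ A B w y (B∌ y N≤y y<S))

    adjacent-step-B : ∀ w y → S ≤ y → adj g′ w y ≡ adjacent B w y
    adjacent-step-B w y S≤y = trans (cong (λ E → adjacent E w y) edges-step) (adjacent-++ʳ′ A B w y (A∌ y S≤y))

  proper-fresh-step : All (λ e → ProperEdge M e × Fresh N e) (edges g′)
  proper-fresh-step = subst (All _) (sym edges-step)
    (++⁺ (SE.sub-proper-fresh N (edges g) 1≤r ends ≤-refl S≤M)
         (SC.sub-proper-fresh S (loops N) (≤-trans (s≤s z≤n) 2≤s) (loops-ends N) N≤S
                              (≤-reflexive (cong (λ n → S + n * s) length-loops))))

  proper-step : All (ProperEdge M) (edges g′)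
  proper-step = All.map proj₁ proper-fresh-step

  old-old : ∀ {w y} → w < N → y < N → adj g′ w y ≡ false
  old-old = fresh⇒¬adjacent (edges g′) (All.map proj₂ proper-fresh-step)

  incidence-step-old : ∀ w → w < N → incidence (edges g′) w ≡ incidence (edges g) w + 2
  incidence-step-old w w<N = begin
    incidence (edges g′) w              ≡⟨ cong (λ E → incidence E w) edges-step ⟩
    incidence (A ++ B) w                ≡⟨ incidence-++ A B w ⟩
    incidence A w + incidence B w       ≡⟨ cong₂ _+_ (SE.incidence-sub-below N (edges g) w w<N)
                                                     (trans (SC.incidence-sub-below S (loops N) w (<-≤-trans w<N N≤S))
                                                            (incidence-loops-< N w w<N)) ⟩
    incidence (edges g) w + 2           ∎
    where open ≡-Reasoning

  incidence-step-new : ∀ x → N ≤ x → x < M → incidence (edges g′) x ≡ 2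
  incidence-step-new x N≤x x<M =
    trans (cong (λ E → incidence E x) edges-step) (trans (incidence-++ A B x) (split (x <? S)))
    where
    split : Dec (x < S) → incidence A x + incidence B x ≡ 2
    split (yes x<S) = cong₂ _+_ (SE.incidence-sub-inside N (edges g) x ends ≤-refl N≤x x<S) (B∌ x N≤x x<S)
    split (no  x≮S) = cong₂ _+_ (A∌ x (≮⇒≥ x≮S)) (SC.incidence-sub-inside S (loops N) x (loops-ends N) N≤S (≮⇒≥ x≮S)
                                                      (subst (λ n → x < S + n * s) (sym length-loops) x<M))

  degree-step-old : ∀ w → w < N → degree g′ w ≡ incidence (edges g) w + 2
  degree-step-old w w<N = begin
    degree g′ w                                                              ≡⟨ degree-∑ g′ w ⟩
    ∑ (N + length (edges g) * r + N * s) f                                   ≡⟨ ∑-split S (N * s) f ⟩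
    ∑ (N + length (edges g) * r) f + ∑ (N * s) (λ t → f (S + t))
      ≡⟨ cong (_+ ∑ (N * s) (λ t → f (S + t))) (∑-split N (length (edges g) * r) f) ⟩
    ∑ N f + ∑ (length (edges g) * r) (λ t → f (N + t)) + ∑ (N * s) (λ t → f (S + t))
      ≡⟨ cong₂ _+_ (cong₂ _+_ (∑-zero N f (λ y y<N → cong ind (old-old w<N y<N))) subdivision-part) cycle-part ⟩
    incidence (edges g) w + 2                                                ∎
    where
    open ≡-Reasoning
    f : ℕ → ℕ
    f y = ind (adj g′ w y)
    subdivision-part : ∑ (length (edges g) * r) (λ t → f (N + t)) ≡ incidence (edges g) w
    subdivision-part =
      trans (∑-cong _ (λ t t<L → cong ind (adjacent-step-A w (N + t) (m≤m+n N t) (+-monoʳ-< N t<L))))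
            (SE.∑-adjacent-sub N (edges g) w 1≤r ends (All.map (λ e → inj₁ (proj₂ (proj₂ e))) proper) ≤-refl w<N)
    cycle-part : ∑ (N * s) (λ t → f (S + t)) ≡ 2
    cycle-part = begin
      ∑ (N * s) (λ t → f (S + t))
        ≡⟨ ∑-cong (N * s) (λ t _ → cong ind (adjacent-step-B w (S + t) (m≤m+n S t))) ⟩
      ∑ (N * s) (λ t → ind (adjacent B w (S + t)))
        ≡⟨ cong (λ n → ∑ (n * s) (λ t → ind (adjacent B w (S + t)))) (sym length-loops) ⟩
      ∑ (length (loops N) * s) (λ t → ind (adjacent B w (S + t)))
        ≡⟨ SC.∑-adjacent-sub S (loops N) w (≤-trans (s≤s z≤n) 2≤s) (loops-ends N) (All.universal (λ _ → inj₂ 2≤s) _) N≤S w<N ⟩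
      incidence (loops N) w
        ≡⟨ incidence-loops-< N w w<N ⟩
      2
        ∎

  private
    lift-A : ∀ {u b k v} → PathBlock A u b k v → N ≤ b → b + k ≤ S → PathBlock (edges g′) u b k v
    lift-A blk N≤b end≤S = subst (λ E → PathBlock E _ _ _ _) (sym edges-step)
      (block-++ˡ blk (λ z b≤z z<end → B∌ z (≤-trans N≤b b≤z) (<-≤-trans z<end end≤S)))

    lift-B : ∀ {u b k v} → PathBlock B u b k v → S ≤ b → PathBlock (edges g′) u b k v
    lift-B blk S≤b = subst (λ E → PathBlock E _ _ _ _) (sym edges-step)
      (block-++ʳ blk (λ z b≤z _ → A∌ z (≤-trans S≤b b≤z)))

  record SubdivisionVertex (x : ℕ) : Set where
    field
      u b v : ℕ
      block : PathBlock (edges g′) u b r v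
      u≢v   : u ≢ v
      u<N   : u < N
      v<N   : v < N
      end≤S : b + r ≤ S
      b≤x   : b ≤ x
      x<end : x < b + r

  subdivision-vertex : ∀ x → N ≤ x → x < S → SubdivisionVertex x
  subdivision-vertex x N≤x x<S = record
    { u = u ; b = b ; v = v
    ; block = lift-A (subst (λ es → PathBlock (SE.sub N es) u b r v) (sym split)
                            (SE.sub-block N before u v after (subst (All _) split ends) ≤-refl))
                     N≤b end≤S
    ; u≢v = proj₂ (proj₂ uv-proper) ; u<N = proj₁ uv-proper ; v<N = proj₁ (proj₂ uv-proper)
    ; end≤S = end≤S ; b≤x = lower ; x<end = upper
    }
    where
    loc = SE.locate N (edges g) x N≤x x<S
    open SE.Located loc
    b = N + length before * r
    N≤b = m≤m+n N _
    end≤S = SE.located-within loc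
    uv-proper : ProperEdge N (u , v)
    uv-proper = All.head (++⁻ʳ before (subst (All _) split proper))

  cycle-block : ∀ j → j < N → PathBlock (edges g′) j (S + j * s) s j
  cycle-block j j<N =
    let xs , ys , split , len = applyUpTo-at (λ j → j , j) j j<N
    in  lift-B (subst₂ (λ es n → PathBlock (SC.sub S es) j (S + n * s) s j) (sym split) len
                       (SC.sub-block S xs j j ys (subst (All _) split (loops-ends N)) N≤S))
               (m≤m+n S _)

  cycle-end : ∀ j → j < N → S + j * s + s ≤ M
  cycle-end j j<N = begin
    S + j * s + s    ≡⟨ +-assoc S (j * s) s ⟩
    S + (j * s + s)  ≡⟨ cong (S +_) (+-comm (j * s) s) ⟩
    S + suc j * s    ≤⟨ +-monoʳ-≤ S (*-monoˡ-≤ s j<N) ⟩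
    M                ∎
    where open ≤-Reasoning

  cycle-vertex : ∀ x → S ≤ x → x < M → ∃ λ j → j < N × S + j * s ≤ x × x < S + j * s + s
  cycle-vertex x S≤x x<M =
    let loc = SC.locate S (loops N) x S≤x (subst (λ n → x < S + n * s) (sym length-loops) x<M)
        open SC.Located loc
    in  length before , subst (length before <_) length-loops (split-length< before after split) , lower , upper

  degree-step-new : ∀ x → N ≤ x → x < M → degree g′ x ≡ 2
  degree-step-new x N≤x x<M with x <? S
  ... | yes x<S =
    let open SubdivisionVertex (subdivision-vertex x N≤x x<S)
        t , t<r , x≡ = block-vertex block b≤x x<end
    in  subst (λ x → degree g′ x ≡ 2) (sym x≡) (proj₁ (block-vertex-degree-nbrEdges block (≤-trans end≤S S≤M) (inj₁ u≢v) t<r))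
  ... | no x≮S =
    let j , j<N , lower , upper = cycle-vertex x (≮⇒≥ x≮S) x<M
        t , t<s , x≡ = block-vertex (cycle-block j j<N) lower upper
    in  subst (λ x → degree g′ x ≡ 2) (sym x≡)
              (proj₁ (block-vertex-degree-nbrEdges (cycle-block j j<N) (cycle-end j j<N) (inj₂ 2≤s) t<s))

  nbrEdges-step-subdivision : ∀ x → N ≤ x → x < S → nbrEdges g′ x ≡ 0
  nbrEdges-step-subdivision x N≤x x<S =
    let open SubdivisionVertex (subdivision-vertex x N≤x x<S)
        t , t<r , x≡ = block-vertex block b≤x x<end
    in  subst (λ x → nbrEdges g′ x ≡ 0) (sym x≡)
          (trans (proj₂ (block-vertex-degree-nbrEdges block (≤-trans end≤S S≤M) (inj₁ u≢v) t<r))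
                 (cong ind (¬-not λ closed → u≢v (proj₁ (block-neighbours-adjacent⇒triangle block (old-old u<N v<N) t<r closed)))))

  private
    cycle-vertex-nbrEdges : ∀ x → S ≤ x → x < M → ∃ λ j → j < N × ∃ λ t → t < s ×
                            nbrEdges g′ x ≡ ind (adj g′ (pathVertex j (S + j * s) s j t) (pathVertex j (S + j * s) s j (2 + t)))
    cycle-vertex-nbrEdges x S≤x x<M =
      let j , j<N , lower , upper = cycle-vertex x S≤x x<M
          t , t<s , x≡ = block-vertex (cycle-block j j<N) lower upper
      in  j , j<N , t , t<s ,
          trans (cong (nbrEdges g′) x≡) (proj₂ (block-vertex-degree-nbrEdges (cycle-block j j<N) (cycle-end j j<N) (inj₂ 2≤s) t<s))

  nbrEdges-step-cycle-triangle : s ≡ 2 → ∀ x → S ≤ x → x < M → nbrEdges g′ x ≡ 1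
  nbrEdges-step-cycle-triangle refl x S≤x x<M =
    let j , j<N , t , t<2 , eq = cycle-vertex-nbrEdges x S≤x x<M
    in  trans eq (cong ind (triangle-block-closed (cycle-block j j<N) t<2))

  nbrEdges-step-cycle-long : s ≢ 2 → ∀ x → S ≤ x → x < M → nbrEdges g′ x ≡ 0
  nbrEdges-step-cycle-long s≢2 x S≤x x<M =
    let j , j<N , t , t<s , eq = cycle-vertex-nbrEdges x S≤x x<M
    in  trans eq (cong ind (¬-not λ closed →
          s≢2 (proj₂ (block-neighbours-adjacent⇒triangle (cycle-block j j<N) (old-old j<N j<N) t<s closed))))

  private
    cycle-triangle-position : ∀ {j t w c a} → w < N → c < a → t < 2 → s ≡ 2 →
                              let P = pathVertex j (S + j * s) s j in
                              a ≡ P (suc t) → (w ≡ P t × c ≡ P (2 + t)) ⊎ (w ≡ P (2 + t) × c ≡ P t) →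
                              a ≡ suc (S + w * s) × c ≡ S + w * s
    cycle-triangle-position {j} {zero}     w<N c<a _ refl refl (inj₁ (_ , refl)) = contradiction c<a (<-asym (n<1+n _))
    cycle-triangle-position {j} {zero}     w<N c<a _ refl refl (inj₂ (refl , _)) =
      contradiction w<N (≤⇒≯ (≤-trans N≤S (≤-trans (m≤m+n S (j * 2)) (n≤1+n _))))
    cycle-triangle-position {j} {suc zero} w<N c<a _ refl refl (inj₁ (refl , _)) =
      contradiction w<N (≤⇒≯ (≤-trans N≤S (m≤m+n S (j * 2))))
    cycle-triangle-position {j} {suc zero} w<N c<a _ refl refl (inj₂ (refl , refl)) = refl , refl
    cycle-triangle-position {t = suc (suc _)} _ _ (s≤s (s≤s ())) _ _ _

    adjacent-step-≢ : ∀ {w c} → adj g′ w c ≡ true → w ≢ c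
    adjacent-step-≢ {w} w~c refl = contradiction (trans (sym w~c) (adjacent-irrefl (edges g′) w proper-step)) λ ()

    triangle-through-block : ∀ {u b k v w a c t} → PathBlock (edges g′) u b k v → u < N → v < N → t < k →
                             a ≡ pathVertex u b k v (suc t) → adj g′ w a ≡ true → adj g′ w c ≡ true → adj g′ a c ≡ true →
                             let P = pathVertex u b k v in
                             ((w ≡ P t × c ≡ P (2 + t)) ⊎ (w ≡ P (2 + t) × c ≡ P t)) × u ≡ v × k ≡ 2
    triangle-through-block {w = w} {a} blk u<N v<N t<k refl w~a w~c a~c =
      block-triangle blk (old-old u<N v<N) t<k (adjacent-step-≢ w~c) (trans (adjacent-sym (edges g′) a w) w~a) a~c w~c

    -- In a triangle w a c at an old vertex w, the new vertex a has the adjacent neighbours w and c,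
    -- so a lies on an attached triangle, and that triangle is the one attached at w.
    old-triangle : ∀ {w a c} → w < N → c < a → a < M → (adj g′ w a ∧ adj g′ w c ∧ adj g′ a c) ≡ true →
                   s ≡ 2 × a ≡ suc (S + w * s) × c ≡ S + w * s
    old-triangle {w} {a} {c} w<N c<a a<M h≡true with ∧≡true⇒ (adj g′ w a) h≡true
    ... | w~a , rest with ∧≡true⇒ (adj g′ w c) rest
    ... | w~c , a~c with a <? N | a <? S
    ... | yes a<N | _       = contradiction (trans (sym w~a) (old-old w<N a<N)) λ ()
    ... | no  a≮N | yes a<S =
      let open SubdivisionVertex (subdivision-vertex a (≮⇒≥ a≮N) a<S)
          t , t<r , a≡ = block-vertex block b≤x x<end
      in  contradiction (proj₁ (proj₂ (triangle-through-block block u<N v<N t<r a≡ w~a w~c a~c))) u≢v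
    ... | no  _   | no  a≮S =
      let j , j<N , lower , upper = cycle-vertex a (≮⇒≥ a≮S) a<M
          t , t<s , a≡ = block-vertex (cycle-block j j<N) lower upper
          position , _ , s≡2 = triangle-through-block (cycle-block j j<N) j<N j<N t<s a≡ w~a w~c a~c
      in  s≡2 , cycle-triangle-position w<N c<a (subst (t <_) s≡2 t<s) s≡2 a≡ position

  nbrEdges-step-old-triangle : s ≡ 2 → ∀ w → w < N → nbrEdges g′ w ≡ 1
  nbrEdges-step-old-triangle refl w w<N =
    trans (nbrEdges-∑ g′ w)
          (trans (∑-pairs-single M _ (n<1+n C) C+1<M (λ a c c<a a<M h≡true → proj₂ (old-triangle w<N c<a a<M h≡true)))
                 (cong ind (trans (cong₂ (λ p q → p ∧ q ∧ adj g′ (suc C) C) w~C+1 w~C) C+1~C)))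
    where
    C = S + w * 2
    C+1<M : suc C < M
    C+1<M = <-≤-trans (subst (suc C <_) (+-comm 2 C) (n<1+n (suc C))) (cycle-end w w<N)
    triangle = triangle-block-edges (cycle-block w w<N)
    w~C = proj₁ triangle
    w~C+1 = proj₁ (proj₂ triangle)
    C+1~C = proj₂ (proj₂ triangle)

  nbrEdges-step-old-long : s ≢ 2 → ∀ w → w < N → nbrEdges g′ w ≡ 0
  nbrEdges-step-old-long s≢2 w w<N =
    trans (nbrEdges-∑ g′ w) (∑-pairs-zero M _ (λ a c c<a a<M h≡true → s≢2 (proj₁ (old-triangle w<N c<a a<M h≡true))))

module ℚSum = FiniteSum ℚP.+-0-isCommutativeMonoid

toℚ-+ : ∀ a b → toℚ (a + b) ≡ toℚ a ℚ.+ toℚ b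
toℚ-+ a b = ℚP.toℚᵘ-injective (begin
  toℚᵘ (toℚ (a + b))               ≈⟨ normalised (a + b) ⟩
  whole (a + b)                    ≈⟨ ℚᵘ.*≡* (trans (cong (ℤ._* ℤ.1ℤ) (ℤP.pos-+ a b)) (*1-distrib (ℤ.+ a) (ℤ.+ b))) ⟩
  whole a ℚᵘ.+ whole b             ≈⟨ ℚᵘP.+-cong (ℚᵘP.≃-sym (normalised a)) (ℚᵘP.≃-sym (normalised b)) ⟩
  toℚᵘ (toℚ a) ℚᵘ.+ toℚᵘ (toℚ b)   ≈⟨ ℚᵘP.≃-sym (ℚP.toℚᵘ-homo-+ (toℚ a) (toℚ b)) ⟩
  toℚᵘ (toℚ a ℚ.+ toℚ b)           ∎)
  where
  open ℚᵘP.≃-Reasoning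
  whole : ℕ → ℚᵘ.ℚᵘ
  whole n = ℚᵘ.mkℚᵘ (ℤ.+ n) 0
  normalised : ∀ n → toℚᵘ (toℚ n) ℚᵘ.≃ whole n
  normalised n = ℚP.toℚᵘ-fromℚᵘ (whole n)
  *1-distrib : ∀ x y → (x ℤ.+ y) ℤ.* ℤ.1ℤ ≡ (x ℤ.* ℤ.1ℤ ℤ.+ y ℤ.* ℤ.1ℤ) ℤ.* ℤ.1ℤ
  *1-distrib = ℤSolver.solve-∀

toℚ-∸ : ∀ a b → b ≤ a → toℚ a ℚ.- toℚ b ≡ toℚ (a ∸ b)
toℚ-∸ a b b≤a = begin
  toℚ a ℚ.- toℚ b                           ≡⟨ cong (λ n → toℚ n ℚ.- toℚ b) (sym (m+[n∸m]≡n b≤a)) ⟩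
  toℚ (b + (a ∸ b)) ℚ.- toℚ b               ≡⟨ cong (ℚ._- toℚ b) (trans (toℚ-+ b (a ∸ b)) (ℚP.+-comm (toℚ b) _)) ⟩
  toℚ (a ∸ b) ℚ.+ toℚ b ℚ.- toℚ b           ≡⟨ ℚP.+-assoc (toℚ (a ∸ b)) (toℚ b) (ℚ.- toℚ b) ⟩
  toℚ (a ∸ b) ℚ.+ (toℚ b ℚ.- toℚ b)         ≡⟨ cong (toℚ (a ∸ b) ℚ.+_) (ℚP.+-inverseʳ (toℚ b)) ⟩
  toℚ (a ∸ b) ℚ.+ 0ℚ                        ≡⟨ ℚP.+-identityʳ (toℚ (a ∸ b)) ⟩
  toℚ (a ∸ b)                               ∎
  where open ≡-Reasoning

∑-const : ∀ n c → ℚSum.∑ n (λ _ → c) ≡ toℚ n ℚ.* c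
∑-const zero    c = sym (ℚP.*-zeroˡ c)
∑-const (suc n) c = begin
  c ℚ.+ ℚSum.∑ n (λ _ → c)        ≡⟨ cong₂ ℚ._+_ (sym (ℚP.*-identityˡ c)) (∑-const n c) ⟩
  1ℚ ℚ.* c ℚ.+ toℚ n ℚ.* c        ≡⟨ sym (ℚP.*-distribʳ-+ c 1ℚ (toℚ n)) ⟩
  (1ℚ ℚ.+ toℚ n) ℚ.* c            ≡⟨ cong (ℚ._* c) (sym (toℚ-+ 1 n)) ⟩
  toℚ (suc n) ℚ.* c               ∎
  where open ≡-Reasoning

divN-zero : ∀ d → divN 0ℚ d ≡ 0ℚ
divN-zero zero    = refl
divN-zero (suc d) = ℚP.*-zeroˡ ((ℤ.+ 1) / suc d)

divN-scale : ∀ c d → toℚ c ℚ.* divN 1ℚ d ≡ divN (toℚ c) d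
divN-scale c zero    = ℚP.*-zeroʳ (toℚ c)
divN-scale c (suc d) = cong (toℚ c ℚ.*_) (ℚP.*-identityˡ ((ℤ.+ 1) / suc d))

1/-* : ∀ a b → (ℤ.+ 1) / (suc a * suc b) ≡ ((ℤ.+ 1) / suc a) ℚ.* ((ℤ.+ 1) / suc b)
1/-* a b = ℚP.toℚᵘ-injective (begin
  toℚᵘ ((ℤ.+ 1) / (suc a * suc b))                      ≈⟨ normalised (b + a * suc b) ⟩
  reciprocal (b + a * suc b)                            ≈⟨ ℚᵘ.*≡* refl ⟩
  reciprocal a ℚᵘ.* reciprocal b                        ≈⟨ ℚᵘP.*-cong (ℚᵘP.≃-sym (normalised a)) (ℚᵘP.≃-sym (normalised b)) ⟩
  toℚᵘ ((ℤ.+ 1) / suc a) ℚᵘ.* toℚᵘ ((ℤ.+ 1) / suc b)   ≈⟨ ℚᵘP.≃-sym (ℚP.toℚᵘ-homo-* ((ℤ.+ 1) / suc a) ((ℤ.+ 1) / suc b)) ⟩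
  toℚᵘ (((ℤ.+ 1) / suc a) ℚ.* ((ℤ.+ 1) / suc b))       ∎)
  where
  open ℚᵘP.≃-Reasoning
  reciprocal : ℕ → ℚᵘ.ℚᵘ
  reciprocal d = ℚᵘ.mkℚᵘ (ℤ.+ 1) d
  normalised : ∀ d → toℚᵘ ((ℤ.+ 1) / suc d) ℚᵘ.≃ reciprocal d
  normalised d = ℚP.toℚᵘ-fromℚᵘ (reciprocal d)

2*nC2≡n*[n∸1] : ∀ n → 2 * (n C 2) ≡ n * (n ∸ 1)
2*nC2≡n*[n∸1] zero    = refl
2*nC2≡n*[n∸1] (suc n) = begin
  2 * (suc n C 2)              ≡⟨ cong (2 *_) (sym (nCk+nC[k+1]≡[n+1]C[k+1] n 1)) ⟩
  2 * (n C 1 + n C 2)          ≡⟨ cong (λ k → 2 * (k + n C 2)) (nC1≡n n) ⟩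
  2 * (n + n C 2)              ≡⟨ *-distribˡ-+ 2 n (n C 2) ⟩
  2 * n + 2 * (n C 2)          ≡⟨ cong (λ k → 2 * n + k) (2*nC2≡n*[n∸1] n) ⟩
  2 * n + n * (n ∸ 1)          ≡⟨ pascal n ⟩
  suc n * n                    ∎
  where
  open ≡-Reasoning
  pascal : ∀ n → 2 * n + n * (n ∸ 1) ≡ suc n * n
  pascal zero    = refl
  pascal (suc n) = polynomial n
    where
    polynomial : ∀ n → 2 * suc n + suc n * n ≡ suc (suc n) * suc n
    polynomial = solve-∀

divN-2-pairs : ∀ D → divN (toℚ 2) (D * (D ∸ 1)) ≡ divN 1ℚ (D C 2)
divN-2-pairs zero          = refl
divN-2-pairs (suc zero)    = refl
divN-2-pairs (suc (suc e)) with suc (suc e) C 2 | 2*nC2≡n*[n∸1] (suc (suc e))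
... | suc X | 2X≡D[D-1] = begin
  divN (toℚ 2) (suc (suc e) * suc e)                   ≡⟨ cong (divN (toℚ 2)) (sym 2X≡D[D-1]) ⟩
  toℚ 2 ℚ.* ((ℤ.+ 1) / (2 * suc X))                      ≡⟨ cong (toℚ 2 ℚ.*_) (1/-* 1 X) ⟩
  toℚ 2 ℚ.* (((ℤ.+ 1) / 2) ℚ.* ((ℤ.+ 1) / suc X))          ≡⟨ sym (ℚP.*-assoc (toℚ 2) ((ℤ.+ 1) / 2) ((ℤ.+ 1) / suc X)) ⟩
  divN 1ℚ (suc X)                                      ∎
  where open ≡-Reasoning

clustering-no-triangle : ∀ g x → nbrEdges g x ≡ 0 → clustering g x ≡ 0ℚ
clustering-no-triangle g x eq =
  trans (cong (λ e → divN (toℚ (2 * e)) (degree g x * (degree g x ∸ 1))) eq)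
        (divN-zero (degree g x * (degree g x ∸ 1)))

clustering-one-triangle : ∀ g x → nbrEdges g x ≡ 1 → clustering g x ≡ divN 1ℚ (degree g x C 2)
clustering-one-triangle g x eq =
  trans (cong (λ e → divN (toℚ (2 * e)) (degree g x * (degree g x ∸ 1))) eq) (divN-2-pairs (degree g x))

avgClustering-∑ : ∀ g → avgClustering g ≡ divN (ℚSum.∑ (size g) (clustering g)) (size g)
avgClustering-∑ g =
  cong (λ q → divN q (size g)) (trans (cong sumℚ (map-upTo (clustering g) (size g))) (ℚSum.foldr-applyUpTo (size g) _))

avgClustering-triangle-free : ∀ g → (∀ x → x < size g → nbrEdges g x ≡ 0) → avgClustering g ≡ 0ℚ
avgClustering-triangle-free g free = begin
  avgClustering g                                  ≡⟨ avgClustering-∑ g ⟩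
  divN (ℚSum.∑ (size g) (clustering g)) (size g)
    ≡⟨ cong (λ q → divN q (size g)) (ℚSum.∑-zero (size g) _ λ x x<n → clustering-no-triangle g x (free x x<n)) ⟩
  divN 0ℚ (size g)                                 ≡⟨ divN-zero (size g) ⟩
  0ℚ                                               ∎
  where open ≡-Reasoning

module Iteration {r s : ℕ} (1≤r : 1 ≤ r) (2≤s : 2 ≤ s) where

  -- G^(i) is the (i+1)-st iterate from the one-vertex graph: attaching C_n to its only vertex gives C_n.
  H : ℕ → Graph
  H zero    = mkGraph 1 []
  H (suc k) = step (suc r) (suc s) (H k)

  proper : ∀ k → All (ProperEdge (size (H k))) (edges (H k))
  proper zero    = []
  proper (suc k) = Step.proper-step 1≤r 2≤s (H k) (proper k)

  module StepAt (k : ℕ) = Step 1≤r 2≤s (H k) (proper k)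

  G≡H : ∀ i → G (suc r) (suc s) i ≡ H (suc i)
  G≡H zero    = cong₂ mkGraph (cong suc (sym (+-identityʳ s))) (cong (λ l → consecutive (l ++ [ 0 ])) (range-suc 0 s))
  G≡H (suc i) = cong (step (suc r) (suc s)) (G≡H i)

  V≡size : ∀ k → V (suc r) (suc s) k ≡ size (H k)
  V≡size zero    = refl
  V≡size (suc k) = cong size (G≡H k)

  size-≤ : ∀ k → size (H k) ≤ size (H (suc k))
  size-≤ k = ≤-trans (StepAt.N≤S k) (StepAt.S≤M k)

  size-mono : ∀ d k → size (H k) ≤ size (H (d + k))
  size-mono zero    k = ≤-refl
  size-mono (suc d) k = ≤-trans (size-mono d k) (size-≤ (d + k))

  incidence-aged : ∀ d {k v} → v < size (H k) → incidence (edges (H k)) v ≡ 2 → incidence (edges (H (d + k))) v ≡ 2 + 2 * d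
  incidence-aged zero    {k} {v} _   born = trans born (cong suc (cong suc (sym (*-zeroʳ 2))))
  incidence-aged (suc d) {k} {v} v<n born = begin
    incidence (edges (H (suc (d + k)))) v   ≡⟨ StepAt.incidence-step-old (d + k) v (<-≤-trans v<n (size-mono d k)) ⟩
    incidence (edges (H (d + k))) v + 2     ≡⟨ cong (_+ 2) (incidence-aged d v<n born) ⟩
    2 + 2 * d + 2                           ≡⟨ arithmetic d ⟩
    2 + 2 * suc d                           ∎
    where
    open ≡-Reasoning
    arithmetic : ∀ d → 2 + 2 * d + 2 ≡ 2 + 2 * suc d
    arithmetic = solve-∀

  incidence-born : ∀ k v → size (H k) ≤ v → v < size (H (suc k)) → incidence (edges (H (suc k))) v ≡ 2
  incidence-born = StepAt.incidence-step-new

  incidence-first : ∀ v → v < size (H 1) → incidence (edges (H 1)) v ≡ 2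
  incidence-first zero    v<n = StepAt.incidence-step-old 0 0 (s≤s z≤n)
  incidence-first (suc v) v<n = incidence-born 0 (suc v) (s≤s z≤n) v<n

avgClustering-long-cycles : ∀ {r s} → 1 ≤ r → 3 ≤ s → ∀ i → avgClustering (G (suc r) (suc s) i) ≡ 0ℚ
avgClustering-long-cycles {r} {s} 1≤r 3≤s i =
  trans (cong avgClustering (G≡H i)) (avgClustering-triangle-free (H (suc i)) triangle-free)
  where
  open Iteration 1≤r (≤-trans (n≤1+n 2) 3≤s)
  open StepAt i
  s≢2 : s ≢ 2
  s≢2 refl = contradiction 3≤s (<-irrefl refl)
  triangle-free : ∀ x → x < M → nbrEdges g′ x ≡ 0
  triangle-free x x<M with x <? N | x <? S
  ... | yes x<N | _       = nbrEdges-step-old-long s≢2 x x<N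
  ... | no  x≮N | yes x<S = nbrEdges-step-subdivision x (≮⇒≥ x≮N) x<S
  ... | no  _   | no  x≮S = nbrEdges-step-cycle-long s≢2 x (≮⇒≥ x≮S) x<M

module Triangles {r : ℕ} (1≤r : 1 ≤ r) (i : ℕ) where
  open Iteration {r} {2} 1≤r ≤-refl
  open StepAt (suc i)

  Δ : ℕ → ℕ
  Δ j = size (H (suc (suc j))) ∸ size (H (suc j))

  clustering-old : ∀ x d → x < N → incidence (edges (H (suc i))) x ≡ 2 + 2 * d →
                   clustering g′ x ≡ divN 1ℚ ((2 * (d + 2)) C 2)
  clustering-old x d x<N aged = begin
    clustering g′ x                           ≡⟨ clustering-one-triangle g′ x (nbrEdges-step-old-triangle refl x x<N) ⟩
    divN 1ℚ (degree g′ x C 2)                 ≡⟨ cong (λ D → divN 1ℚ (D C 2)) (trans (degree-step-old x x<N) (cong (_+ 2) aged)) ⟩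
    divN 1ℚ ((2 + 2 * d + 2) C 2)             ≡⟨ cong (λ D → divN 1ℚ (D C 2)) (arithmetic d) ⟩
    divN 1ℚ ((2 * (d + 2)) C 2)               ∎
    where
    open ≡-Reasoning
    arithmetic : ∀ d → 2 + 2 * d + 2 ≡ 2 * (d + 2)
    arithmetic = solve-∀

  ∑-clustering-oldest : ℚSum.∑ (size (H 1)) (clustering g′) ≡ divN (toℚ 3) ((2 * (i + 2)) C 2)
  ∑-clustering-oldest = begin
    ℚSum.∑ 3 (clustering g′)                         ≡⟨ ℚSum.∑-cong 3 (λ x x<3 → clustering-old x i (x<N x<3) (aged x x<3)) ⟩
    ℚSum.∑ 3 (λ _ → divN 1ℚ ((2 * (i + 2)) C 2))     ≡⟨ ∑-const 3 (divN 1ℚ ((2 * (i + 2)) C 2)) ⟩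
    toℚ 3 ℚ.* divN 1ℚ ((2 * (i + 2)) C 2)            ≡⟨ divN-scale 3 ((2 * (i + 2)) C 2) ⟩
    divN (toℚ 3) ((2 * (i + 2)) C 2)                 ∎
    where
    open ≡-Reasoning
    x<N : ∀ {x} → x < 3 → x < N
    x<N x<3 = <-≤-trans x<3 (subst (λ k → size (H 1) ≤ size (H k)) (+-comm i 1) (size-mono i 1))
    aged : ∀ x → x < 3 → incidence (edges (H (suc i))) x ≡ 2 + 2 * i
    aged x x<3 = subst (λ k → incidence (edges (H k)) x ≡ 2 + 2 * i) (+-comm i 1) (incidence-aged i x<3 (incidence-first x x<3))

  ∑-clustering-generation : ∀ j → j < i →
                            ℚSum.∑ (Δ j) (λ t → clustering g′ (size (H (suc j)) + t)) ≡ divN (toℚ (Δ j)) ((2 * (i ∸ suc j + 2)) C 2)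
  ∑-clustering-generation j j<i = begin
    ℚSum.∑ (Δ j) (λ t → clustering g′ (size (H (suc j)) + t))
      ≡⟨ ℚSum.∑-cong (Δ j) (λ t t<Δ → clustering-old _ d (x<N t<Δ) (aged t<Δ)) ⟩
    ℚSum.∑ (Δ j) (λ _ → divN 1ℚ ((2 * (d + 2)) C 2))           ≡⟨ ∑-const (Δ j) (divN 1ℚ ((2 * (d + 2)) C 2)) ⟩
    toℚ (Δ j) ℚ.* divN 1ℚ ((2 * (d + 2)) C 2)                  ≡⟨ divN-scale (Δ j) ((2 * (d + 2)) C 2) ⟩
    divN (toℚ (Δ j)) ((2 * (d + 2)) C 2)                       ∎
    where
    open ≡-Reasoning
    d = i ∸ suc j
    d+age : d + suc (suc j) ≡ suc i
    d+age = trans (+-suc d (suc j)) (cong suc (m∸n+n≡m j<i))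
    x<born : ∀ {t} → t < Δ j → size (H (suc j)) + t < size (H (suc (suc j)))
    x<born {t} t<Δ = subst (size (H (suc j)) + t <_) (m+[n∸m]≡n (size-≤ (suc j))) (+-monoʳ-< _ t<Δ)
    x<N : ∀ {t} → t < Δ j → size (H (suc j)) + t < N
    x<N t<Δ = <-≤-trans (x<born t<Δ) (subst (λ k → size (H (suc (suc j))) ≤ size (H k)) d+age (size-mono d (suc (suc j))))
    aged : ∀ {t} → t < Δ j → incidence (edges (H (suc i))) (size (H (suc j)) + t) ≡ 2 + 2 * d
    aged {t} t<Δ = subst (λ k → incidence (edges (H k)) (size (H (suc j)) + t) ≡ 2 + 2 * d) d+age
                         (incidence-aged d (x<born t<Δ) (incidence-born (suc j) _ (m≤m+n _ t) (x<born t<Δ)))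

  ∑-clustering-old : ℚSum.∑ N (clustering g′) ≡
                     divN (toℚ 3) ((2 * (i + 2)) C 2) ℚ.+ ℚSum.∑ i (λ j → divN (toℚ (Δ j)) ((2 * (i ∸ suc j + 2)) C 2))
  ∑-clustering-old =
    trans (ℚSum.∑-telescope (λ j → size (H (suc j))) (λ j → size-≤ (suc j)) i (clustering g′))
          (cong₂ ℚ._+_ ∑-clustering-oldest (ℚSum.∑-cong i ∑-clustering-generation))

  ∑-clustering : ℚSum.∑ M (clustering g′) ≡ ℚSum.∑ N (clustering g′) ℚ.+ toℚ (2 * N)
  ∑-clustering = begin
    ℚSum.∑ M cl
      ≡⟨ ℚSum.∑-split S (N * 2) cl ⟩
    ℚSum.∑ S cl ℚ.+ ℚSum.∑ (N * 2) (λ t → cl (S + t))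
      ≡⟨ cong₂ ℚ._+_ (ℚSum.∑-split N L cl) (ℚSum.∑-cong (N * 2) (λ t t<2N → on-cycle (m≤m+n S t) (+-monoʳ-< S t<2N))) ⟩
    ℚSum.∑ N cl ℚ.+ ℚSum.∑ L (λ t → cl (N + t)) ℚ.+ ℚSum.∑ (N * 2) (λ _ → 1ℚ)
      ≡⟨ cong₂ ℚ._+_ (cong (ℚSum.∑ N cl ℚ.+_) (ℚSum.∑-zero L (λ t → cl (N + t)) on-subdivision)) (∑-const (N * 2) 1ℚ) ⟩
    ℚSum.∑ N cl ℚ.+ 0ℚ ℚ.+ toℚ (N * 2) ℚ.* 1ℚ
      ≡⟨ cong₂ ℚ._+_ (ℚP.+-identityʳ (ℚSum.∑ N cl)) (trans (ℚP.*-identityʳ (toℚ (N * 2))) (cong toℚ (*-comm N 2))) ⟩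
    ℚSum.∑ N cl ℚ.+ toℚ (2 * N)
      ∎
    where
    open ≡-Reasoning
    cl = clustering g′
    L = length (edges (H (suc i))) * r
    on-cycle : ∀ {x} → S ≤ x → x < M → cl x ≡ 1ℚ
    on-cycle {x} S≤x x<M =
      trans (clustering-one-triangle g′ x (nbrEdges-step-cycle-triangle refl x S≤x x<M))
            (cong (λ D → divN 1ℚ (D C 2)) (degree-step-new x (≤-trans N≤S S≤x) x<M))
    on-subdivision : ∀ t → t < L → cl (N + t) ≡ 0ℚ
    on-subdivision t t<L = clustering-no-triangle g′ (N + t) (nbrEdges-step-subdivision (N + t) (m≤m+n N t) (+-monoʳ-< N t<L))

  avgClustering-triangles : avgClustering (G (suc r) 3 (suc i)) ≡ formulaB (suc r) (suc i)
  avgClustering-triangles = begin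
    avgClustering (G (suc r) 3 (suc i))
      ≡⟨ trans (cong avgClustering (G≡H (suc i))) (avgClustering-∑ g′) ⟩
    divN (ℚSum.∑ M (clustering g′)) M
      ≡⟨ cong (λ q → divN q M) (trans ∑-clustering (cong (ℚ._+ toℚ (2 * N)) ∑-clustering-old)) ⟩
    divN (divN (toℚ 3) ((2 * (i + 2)) C 2) ℚ.+ ℚSum.∑ i (λ j → divN (toℚ (Δ j)) ((2 * (i ∸ suc j + 2)) C 2)) ℚ.+ toℚ (2 * N)) M
      ≡⟨ cong₂ divN (cong₂ ℚ._+_ (cong₂ ℚ._+_ (cong (λ k → divN (toℚ 3) ((2 * k) C 2)) (+-suc i 1)) generations)
                                 (cong (λ n → toℚ (2 * n)) (sym (V≡size (suc i)))))
                    (sym (trans (cong (V (suc r) 3) (+-comm (suc i) 1)) (V≡size (suc (suc i))))) ⟩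
    formulaB (suc r) (suc i)
      ∎
    where
    open ≡-Reasoning
    V-step : ∀ j → toℚ (V (suc r) 3 (suc j + 1)) ℚ.- toℚ (V (suc r) 3 (suc j)) ≡ toℚ (Δ j)
    V-step j =
      trans (cong₂ (λ a b → toℚ a ℚ.- toℚ b) (trans (cong (V (suc r) 3) (+-comm (suc j) 1)) (V≡size (suc (suc j)))) (V≡size (suc j)))
            (toℚ-∸ _ _ (size-≤ (suc j)))
    age : ∀ j → j < i → suc i ∸ suc j + 1 ≡ i ∸ suc j + 2
    age j j<i = trans (cong (_+ 1) (+-∸-assoc 1 j<i)) (sym (+-suc (i ∸ suc j) 1))
    generations : ℚSum.∑ i (λ j → divN (toℚ (Δ j)) ((2 * (i ∸ suc j + 2)) C 2)) ≡
                  sumℚ (map (λ j → divN (toℚ (V (suc r) 3 (j + 1)) ℚ.- toℚ (V (suc r) 3 j)) ((2 * (suc i ∸ j + 1)) C 2)) (range 1 i))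
    generations = sym (begin
      sumℚ (map _ (map (1 +_) (upTo i)))            ≡⟨ cong sumℚ (sym (map-∘ (upTo i))) ⟩
      sumℚ (map _ (upTo i))                         ≡⟨ cong sumℚ (map-upTo _ i) ⟩
      sumℚ (applyUpTo _ i)                          ≡⟨ ℚSum.foldr-applyUpTo i _ ⟩
      ℚSum.∑ i _                                    ≡⟨ ℚSum.∑-cong i (λ j j<i → cong₂ divN (V-step j) (cong (λ k → (2 * k) C 2) (age j j<i))) ⟩
      ℚSum.∑ i (λ j → divN (toℚ (Δ j)) ((2 * (i ∸ suc j + 2)) C 2)) ∎)

theorem2 : ((m n : ℕ) → 2 ≤ m → 4 ≤ n → (i : ℕ) → avgClustering (G m n i) ≡ 0ℚ)
         × ((m : ℕ) → 2 ≤ m → (i : ℕ) → 1 ≤ i → avgClustering (G m 3 i) ≡ formulaB m i)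
theorem2 = long-cycles , triangles
  where
  long-cycles : (m n : ℕ) → 2 ≤ m → 4 ≤ n → (i : ℕ) → avgClustering (G m n i) ≡ 0ℚ
  long-cycles (suc r) (suc s) (s≤s 1≤r) (s≤s 3≤s) = avgClustering-long-cycles 1≤r 3≤s
  triangles : (m : ℕ) → 2 ≤ m → (i : ℕ) → 1 ≤ i → avgClustering (G m 3 i) ≡ formulaB m i
  triangles (suc r) (s≤s 1≤r) (suc i) _ = Triangles.avgClustering-triangles 1≤r i
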